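{- (i) The strictly linear combinatory algebra of partial involutions $(\mathcal P,\cdot)$ (with combinators $B,C,I$) is a strictly linear $\lambda$-algebra, but it is not a strictly linear combinatory $\lambda$-model. (ii) The strictly affine combinatory algebra of partial involutions $(\mathcal P,\cdot)$ (with combinators $B,C,I,K$) is not a strictly affine $\lambda$-algebra.
   Context: Partial involutions: $T_\Sigma$ is the set of first-order terms over the constant $e$, unary symbols $l,r$, binary symbol $\langle\ ,\ \rangle$. $\mathcal P$ is the set of partial injective functions $f:T_\Sigma\rightharpoonup T_\Sigma$ with $f(u)=v\iff f(v)=u$. For $i,j\in\{l,r\}$ let $f_{ij}=\{(u,v)\mid(i(u),j(v))\in f\}$; application is $f\cdot g=f_{rr}\cup(f_{rl};g;(f_{ll};g)^*;f_{lr})$ ($;$ = relational composition in diagrammatic order, ${}^*$ = reflexive–transitive closure). A list $u_1\leftrightarrow v_1,\dots$ of terms with pattern variables denotes the involution mapping each instance of $u_i$ to the corresponding instance of $v_i$ and vice versa. Combinators: $B: r^3x\leftrightarrow lrx,\ l^2x\leftrightarrow rlrx,\ rl^2x\leftrightarrow r^2lx$; $C: l^2x\leftrightarrow r^2lx,\ lrlx\leftrightarrow rlx,\ lr^2x\leftrightarrow r^3x$; $I: lx\leftrightarrow rx$; $K: lx\leftrightarrow r^2x$. These satisfy $Bxyz=x(yz)$, $Ix=x$, $Cxyz=(xz)y$, $Kxy=x$ in $(\mathcal P,\cdot)$. For a combinatory algebra $\mathcal A=(A,\cdot)$ with combinators $B,C,I$ (strictly linear case) or $B,C,I,K$ (strictly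 affine case), $\mathcal T(\mathcal A)$ is the set of terms built from variables, these combinators and constants $c_a$ ($a\in A$) by application, and $[\![\cdot]\!]_{\mathcal A}$ is the natural interpretation of closed terms. The strictly linear (resp. affine) $\lambda$-calculus has terms built by application and abstraction $\lambda x.M$ allowed only when $x$ occurs free in $M$ exactly once (resp. at most once); its provable equality $=_{\lambda^L}$ (resp. $=_{\lambda^A}$) is generated by $(\lambda x.M)N=M[N/x]$, the rule "from $M=N$ with $x$ free exactly once (resp. at most once) in $M$ and in $N$ infer $\lambda x.M=\lambda x.N$", and congruence rules. The translation $(\cdot)_\lambda$ replaces $B,C,I,K$ by $\lambda xyz.x(yz)$, $\lambda xyz.(xz)y$, $\lambda x.x$, $\lambda xy.x$. $\mathcal A$ is a strictly linear (resp. affine) $\lambda$-algebra if for all closed $M,N\in\mathcal T(\mathcal A)$, $(M)_\lambda=_{\lambda^L}(N)_\lambda$ (resp. $=_{\lambda^A}$) implies $[\![M]\!]_{\mathcal A}=[\![N]\!]_{\mathcal A}$. It is a strictly linear combinatory $\lambda$-model if there is $\epsilon\in A$ such that for all $x,y$: $\epsilon xy=xy$, and $(\forall z.\ xz=yz)\Rightarrow\epsilon x=\epsilon y$. -}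

module Defs where

open import Data.Nat using (ℕ; zero; suc; _≤_)
open import Data.Fin using (Fin; zero; suc; _≟_)
open import Data.Bool using (Bool; true; false; if_then_else_)
open import Data.Product using (Σ; _×_; _,_)
open import Data.Sum using (_⊎_)
open import Relation.Nullary using (¬_; does)
open import Relation.Binary.PropositionalEquality using (_≡_)
open import Relation.Binary.Construct.Closure.ReflexiveTransitive using (Star)

data Tm : Set where
  e     : Tm
  l r   : Tm → Tm
  ⟨_,_⟩ : Tm → Tm → Tm

Rel : Set₁
Rel = Tm → Tm → Set

record IsPInv (f : Rel) : Set where
  field
    functional : ∀ {u v w} → f u v → f u w → v ≡ w
    injective  : ∀ {u v w} → f u w → f v w → u ≡ v
    symmetric  : ∀ {u v} → f u v → f v u

PInv : Set₁
PInv = Σ Rel IsPInv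

_≐_ : Rel → Rel → Set
f ≐ g = ∀ u v → (f u v → g u v) × (g u v → f u v)

_⨾_ : Rel → Rel → Rel
(f ⨾ g) u w = Σ Tm λ v → f u v × g v w

_[_,_] : Rel → (Tm → Tm) → (Tm → Tm) → Rel
(f [ i , j ]) u v = f (i u) (j v)

infixl 9 _·_
_·_ : Rel → Rel → Rel
(f · g) u v =
  (f [ r , r ]) u v ⊎
  ((f [ r , l ]) ⨾ (g ⨾ (Star ((f [ l , l ]) ⨾ g) ⨾ (f [ l , r ])))) u v

data Bᴾ : Rel where
  b₁ : ∀ x → Bᴾ (r (r (r x))) (l (r x))
  b₁' : ∀ x → Bᴾ (l (r x)) (r (r (r x)))
  b₂ : ∀ x → Bᴾ (l (l x)) (r (l (r x)))
  b₂' : ∀ x → Bᴾ (r (l (r x))) (l (l x))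
  b₃ : ∀ x → Bᴾ (r (l (l x))) (r (r (l x)))
  b₃' : ∀ x → Bᴾ (r (r (l x))) (r (l (l x)))

data Cᴾ : Rel where
  c₁ : ∀ x → Cᴾ (l (l x)) (r (r (l x)))
  c₁' : ∀ x → Cᴾ (r (r (l x))) (l (l x))
  c₂ : ∀ x → Cᴾ (l (r (l x))) (r (l x))
  c₂' : ∀ x → Cᴾ (r (l x)) (l (r (l x)))
  c₃ : ∀ x → Cᴾ (l (r (r x))) (r (r (r x)))
  c₃' : ∀ x → Cᴾ (r (r (r x))) (l (r (r x)))

data Iᴾ : Rel where
  i₁ : ∀ x → Iᴾ (l x) (r x)
  i₁' : ∀ x → Iᴾ (r x) (l x)

data Kᴾ : Rel where
  k₁ : ∀ x → Kᴾ (l x) (r (r x))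
  k₁' : ∀ x → Kᴾ (r (r x)) (l x)

-- Closed combinatory terms 𝒯(𝒜) with constants c_a, a ∈ 𝒫.
-- Index: false = strictly linear (B,C,I), true = strictly affine (B,C,I,K).

data CL : Bool → Set₁ where
  `B `C `I : ∀ {b} → CL b
  `K       : CL true
  cst      : ∀ {b} → PInv → CL b
  _`·_     : ∀ {b} → CL b → CL b → CL b

⟦_⟧ : ∀ {b} → CL b → Rel
⟦ `B ⟧ = Bᴾ
⟦ `C ⟧ = Cᴾ
⟦ `I ⟧ = Iᴾ
⟦ `K ⟧ = Kᴾ
⟦ cst (f , _) ⟧ = f
⟦ M `· N ⟧ = ⟦ M ⟧ · ⟦ N ⟧

data Λ (n : ℕ) : Set₁ where
  var  : Fin n → Λ n
  con  : PInv → Λ n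
  app  : Λ n → Λ n → Λ n
  lam  : Λ (suc n) → Λ n

ren : ∀ {m n} → (Fin m → Fin n) → Λ m → Λ n
ren ρ (var i)   = var (ρ i)
ren ρ (con a)   = con a
ren ρ (app M N) = app (ren ρ M) (ren ρ N)
ren ρ (lam M)   = lam (ren (λ { zero → zero ; (suc i) → suc (ρ i) }) M)

sub : ∀ {m n} → (Fin m → Λ n) → Λ m → Λ n
sub σ (var i)   = σ i
sub σ (con a)   = con a
sub σ (app M N) = app (sub σ M) (sub σ N)
sub σ (lam M)   = lam (sub (λ { zero → var zero ; (suc i) → ren suc (σ i) }) M)

_[_/0] : ∀ {n} → Λ (suc n) → Λ n → Λ n
M [ N /0] = sub (λ { zero → N ; (suc i) → var i }) M

occ : ∀ {n} → Fin n → Λ n → ℕ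
occ i (var j)   = if does (i ≟ j) then 1 else 0
occ i (con a)   = 0
occ i (app M N) = occ i M Data.Nat.+ occ i N
occ i (lam M)   = occ (suc i) M

OccOK : Bool → ℕ → Set
OccOK false k = k ≡ 1
OccOK true  k = k ≤ 1

data WF (b : Bool) {n : ℕ} : Λ n → Set₁ where
  wf-var : ∀ {i} → WF b (var i)
  wf-con : ∀ {a} → WF b (con a)
  wf-app : ∀ {M N} → WF b M → WF b N → WF b (app M N)
  wf-lam : ∀ {M} → WF b M → OccOK b (occ zero M) → WF b (lam M)

data _⊢_≈_ (b : Bool) {n : ℕ} : Λ n → Λ n → Set₁ where
  β     : ∀ {M N} → WF b (app (lam M) N) → b ⊢ app (lam M) N ≈ (M [ N /0])
  ξ     : ∀ {M N} → b ⊢ M ≈ N → OccOK b (occ zero M) → OccOK b (occ zero N)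
          → b ⊢ lam M ≈ lam N
  cong· : ∀ {M M' N N'} → b ⊢ M ≈ M' → b ⊢ N ≈ N' → b ⊢ app M N ≈ app M' N'
  refl  : ∀ {M} → WF b M → b ⊢ M ≈ M
  sym   : ∀ {M N} → b ⊢ M ≈ N → b ⊢ N ≈ M
  trans : ∀ {M N P} → b ⊢ M ≈ N → b ⊢ N ≈ P → b ⊢ M ≈ P

toλ : ∀ {b} → CL b → Λ 0
toλ `B = lam (lam (lam (app (var (suc (suc zero))) (app (var (suc zero)) (var zero)))))
toλ `C = lam (lam (lam (app (app (var (suc (suc zero))) (var zero)) (var (suc zero)))))
toλ `I = lam (var zero)
toλ `K = lam (lam (var (suc zero)))
toλ (cst a) = con a
toλ (M `· N) = app (toλ M) (toλ N)

IsStrictlyLinearλAlgebra : Set₁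
IsStrictlyLinearλAlgebra =
  ∀ (M N : CL false) → false ⊢ toλ M ≈ toλ N → ⟦ M ⟧ ≐ ⟦ N ⟧

IsStrictlyAffineλAlgebra : Set₁
IsStrictlyAffineλAlgebra =
  ∀ (M N : CL true) → true ⊢ toλ M ≈ toλ N → ⟦ M ⟧ ≐ ⟦ N ⟧

IsStrictlyLinearCombλModel : Set₁
IsStrictlyLinearCombλModel =
  Σ PInv λ { (ε , _) →
    ∀ (x y : PInv) →
      let x' = Data.Product.proj₁ x ; y' = Data.Product.proj₁ y in
      ((ε · x' · y') ≐ (x' · y'))
      × ((∀ (z : PInv) → (x' · Data.Product.proj₁ z) ≐ (y' · Data.Product.proj₁ z))
         → (ε · x') ≐ (ε · y')) }

-- Terms of the linear λ-calculus are interpreted by a geometry-of-interaction construction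
-- extending ⟦_⟧ to open terms: net M relates the ports of the root and of the free variables of
-- M; application is the execution (feedback along wires) of a circuit connecting the l-side of
-- the function to the argument, exactly as in f · g, and abstraction moves the ports of the
-- bound variable to the l-side of the root.  On the root of closed combinatory terms, net agrees
-- with ⟦_⟧.  It validates β: net (M[N/x]) is the execution of net M with net N plugged into the
-- ports of x, by induction on M, since executions are invariant under circuit morphisms and
-- nested executions can be flattened.  Hence 𝒫 is a strictly linear λ-algebra.
--
-- An ε as in a combinatory λ-model would give (ε I) · {e ↔ e} ∋ (e, e), as I · {e ↔ e} does.
-- Following the path realising this through ε, and testing ε on the involutions ∅ and {b ↔ j},
-- either contradicts functionality of ε or requires ε to relate some r u with l l e; but
-- ε · {l e ↔ l e} = ε · ∅ by extensionality, which forbids that.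
--
-- B (C K) and K (C K) both reduce to λxyz.z in the affine calculus, but ⟦B (C K)⟧ relates l l e
-- with r l e, from the clause r l² x ↔ r² l x of B, while ⟦K (C K)⟧ does not.

module Submission where

open import Defs
open import Data.Bool using (false; true)
open import Data.Empty using (⊥; ⊥-elim)
open import Data.Fin using (Fin; zero; suc; _≟_)
import Data.Fin as Fin
open import Data.Fin.Properties using (suc-injective)
open import Data.Maybe using (Maybe; just; nothing)
open import Data.Maybe.Properties using (map-injective; map-just; map-nothing)
import Data.Maybe as Maybe
open import Data.Nat using (ℕ; zero; suc; _+_; _≤_; _≤?_)
open import Data.Nat.Properties using (m+n≡0⇒m≡0; m+n≡0⇒n≡0)
open import Data.Product using (∃; ∃₂; _×_; _,_; proj₁; proj₂)
open import Data.Sum using (_⊎_; inj₁; inj₂)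
import Data.Sum as Sum
open import Data.Sum.Properties using (inj₁-injective; inj₂-injective)
open import Data.Sum.Relation.Binary.Pointwise using (Pointwise; inj₁; inj₂)
open import Relation.Binary.Core using (_⇒_; _⇔_)
open import Relation.Binary.Construct.Closure.ReflexiveTransitive using (Star; ε; _◅_; _◅◅_)
open import Relation.Binary.PropositionalEquality
  using (_≡_; _≢_; refl; cong; cong₂) renaming (sym to ≡-sym; trans to ≡-trans)
open import Relation.Nullary using (¬_; yes; no)
open import Relation.Nullary.Decidable using (True; toWitness; dec-true)

RelOn : Set → Set₁
RelOn X = X → X → Set

module _ {X : Set} where

  ⇔-refl : {R : RelOn X} → R ⇔ R
  ⇔-refl = (λ z → z) , (λ z → z)

  ⇔-sym : {R Q : RelOn X} → R ⇔ Q → Q ⇔ R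
  ⇔-sym (f , g) = g , f

  ⇔-trans : {R Q T : RelOn X} → R ⇔ Q → Q ⇔ T → R ⇔ T
  ⇔-trans (f , g) (f' , g') = (λ z → f' (f z)) , (λ z → g (g' z))

  ≡⇒⇔ : {R Q : RelOn X} → R ≡ Q → R ⇔ Q
  ≡⇒⇔ refl = ⇔-refl

infixr 9 _⨟_
_⨟_ : {X : Set} → RelOn X → RelOn X → RelOn X
(R ⨟ Q) x z = ∃ λ y → R x y × Q y z

infixr 10 _⊕_
_⊕_ : {A B : Set} → RelOn A → RelOn B → RelOn (A ⊎ B)
_⊕_ = Pointwise

⊕-cong : {A B : Set} {R R' : RelOn A} {Q Q' : RelOn B} → R ⇔ R' → Q ⇔ Q' → (R ⊕ Q) ⇔ (R' ⊕ Q')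
⊕-cong (f , f') (g , g') = (λ { (inj₁ x) → inj₁ (f x) ; (inj₂ y) → inj₂ (g y) })
                         , (λ { (inj₁ x) → inj₁ (f' x) ; (inj₂ y) → inj₂ (g' y) })

Image : {X Y : Set} → (X → Y) → RelOn X → RelOn Y
Image φ R y y' = ∃₂ λ x x' → φ x ≡ y × φ x' ≡ y' × R x x'

image-cong : {X Y : Set} (φ : X → Y) {R R' : RelOn X} → R ⇔ R' → Image φ R ⇔ Image φ R'
image-cong φ (f , g) = (λ { (x , x' , p , q , a) → x , x' , p , q , f a })
                     , (λ { (x , x' , p , q , a) → x , x' , p , q , g a })

image-∘ : {X Y Z : Set} (φ : X → Y) (ψ : Y → Z) (χ : X → Z) → (∀ x → ψ (φ x) ≡ χ x) →
          {R : RelOn X} → Image ψ (Image φ R) ⇔ Image χ R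
image-∘ φ ψ χ eq =
    (λ { (_ , _ , refl , refl , (x , x' , refl , refl , a)) → x , x' , ≡-sym (eq x) , ≡-sym (eq x') , a })
  , (λ { (x , x' , refl , refl , a) → φ x , φ x' , eq x , eq x' , (x , x' , refl , refl , a) })

record Circuit (E : Set) : Set₁ where
  constructor circuit
  field
    Node  : Set
    box   : RelOn Node
    wire  : RelOn Node
    entry : E → Node → Set

  Trip : RelOn Node
  Trip = box ⨟ Star (wire ⨟ box)

open Circuit using (Node; box; wire; entry; Trip)

exec : {E : Set} → Circuit E → RelOn E
exec C x y = ∃₂ λ s s' → entry C x s × entry C y s' × Trip C s s'

exec-cong-box : {E : Set} (C : Circuit E) {F : RelOn (Node C)} → box C ⇔ F →
                exec C ⇔ exec (record C { box = F })
exec-cong-box C {F} (f , g) =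
    (λ { (s , s' , j , j' , (t , b , st)) → s , s' , j , j' , (t , f b , trips f st) })
  , (λ { (s , s' , j , j' , (t , b , st)) → s , s' , j , j' , (t , g b , trips g st) })
  where
  trips : {G H : RelOn (Node C)} → G ⇒ H → Star (wire C ⨟ G) ⇒ Star (wire C ⨟ H)
  trips h ε = ε
  trips h ((z , w , b) ◅ st) = (z , w , h b) ◅ trips h st

image-exec : {E E' : Set} (φ : E → E') (C : Circuit E) →
             Image φ (exec C) ⇔ exec (circuit (Node C) (box C) (wire C) λ x s → ∃ λ x₀ → φ x₀ ≡ x × entry C x₀ s)
image-exec φ C =
    (λ { (x , y , refl , refl , (s , s' , j , j' , p)) → s , s' , (x , refl , j) , (y , refl , j') , p })
  , (λ { (s , s' , (x , refl , j) , (y , refl , j') , p) → x , y , refl , refl , (s , s' , j , j' , p) })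

Endpoint : ∀ {E} (C : Circuit E) → Node C → Set
Endpoint C s = ∃ λ t → box C s t ⊎ box C t s

-- The conditions are only imposed on nodes adjacent to box steps, the only ones a trip visits.
record CircuitMorphism {E : Set} (A B : Circuit E) : Set₁ where
  field
    node           : Node A → Node B
    box-preserve   : ∀ {s t} → box A s t → box B (node s) (node t)
    box-reflect    : ∀ {x y} → box B x y → ∃₂ λ s t → node s ≡ x × node t ≡ y × box A s t
    wire-preserve  : ∀ {s t s' t'} → box A s t → wire A t s' → box A s' t' → wire B (node t) (node s')
    wire-reflect   : ∀ {s t z w} → box A s t → wire B (node t) z → box B z w →
                     ∃₂ λ s' t' → wire A t s' × box A s' t' × node s' ≡ z × node t' ≡ w
    entry-preserve : ∀ {x s} → entry A x s → Endpoint A s → entry B x (node s)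
    entry-reflect  : ∀ {x s} → entry B x (node s) → Endpoint A s → entry A x s

wire-reflect-from : ∀ {S S' : Set} {F W : RelOn S} {F' W' : RelOn S'} (θ : S → S') →
  (∀ {x y} → F' x y → ∃₂ λ s t → θ s ≡ x × θ t ≡ y × F s t) →
  (∀ {s t z} → F s t → W' (θ t) z → ∃ λ s' → W t s' × θ s' ≡ z) →
  (∀ {t s' s'' t''} → W t s' → F s'' t'' → θ s'' ≡ θ s' → s'' ≡ s') →
  ∀ {s t z w} → F s t → W' (θ t) z → F' z w →
  ∃₂ λ s' t' → W t s' × F s' t' × θ s' ≡ z × θ t' ≡ w
wire-reflect-from θ reflect-box reflect-wire injective b w b'
  with reflect-wire b w
... | s' , w₀ , refl with reflect-box b'
... | s'' , t'' , eq , refl , b'' with injective w₀ b'' eq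
... | refl = s' , t'' , w₀ , b'' , refl , refl

module _ {E : Set} {A B : Circuit E} (θ : CircuitMorphism A B) where
  open CircuitMorphism θ

  private
    trip-forth : ∀ {s t u} → box A s t → Star (wire A ⨟ box A) t u →
                 ∃ λ p → box A p u × Star (wire B ⨟ box B) (node t) (node u)
    trip-forth b ε = _ , b , ε
    trip-forth b ((s' , w , b') ◅ st) with trip-forth b' st
    ... | p , bp , st' = p , bp , ((node s' , wire-preserve b w b' , box-preserve b') ◅ st')

    trip-back : ∀ {s t x} → box A s t → Star (wire B ⨟ box B) (node t) x →
                ∃ λ u → node u ≡ x × ∃ λ p → box A p u × Star (wire A ⨟ box A) t u
    trip-back {t = t} b ε = t , refl , _ , b , ε
    trip-back b ((z , w , b') ◅ st) with wire-reflect b w b'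
    ... | s' , t' , w' , b'' , refl , refl with trip-back b'' st
    ... | u , eq , p , bp , st' = u , eq , p , bp , ((s' , w' , b'') ◅ st')

  exec-invariant : exec A ⇔ exec B
  exec-invariant = forth , back
    where
    forth : exec A ⇒ exec B
    forth (s , s' , j , j' , (t , b , st)) with trip-forth b st
    ... | p , bp , st' = node s , node s' , entry-preserve j (_ , inj₁ b) , entry-preserve j' (_ , inj₂ bp) ,
                         (node t , box-preserve b , st')
    back : exec B ⇒ exec A
    back (x , x' , j , j' , (y , b , st)) with box-reflect b
    ... | s , t , refl , refl , b₀ with trip-back b₀ st
    ... | u , refl , p , bp , st' =
      s , u , entry-reflect j (_ , inj₁ b₀) , entry-reflect j' (_ , inj₂ bp) , (t , b₀ , st')

-- Inlining a box that is itself the execution of a circuit A₁: the wires of A₁ are kept and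
-- every outer wire is reattached to the inner nodes of the corresponding entries (Lift).
module Flatten {E E₁ : Set} (A₁ : Circuit E₁) {S : Set} (G : RelOn S)
               (W : RelOn (E₁ ⊎ S)) (J : E → E₁ ⊎ S → Set) where

  outer : Circuit E
  outer = circuit (E₁ ⊎ S) (exec A₁ ⊕ G) W J

  data Lift : E₁ ⊎ S → Node A₁ ⊎ S → Set where
    lift-exec  : ∀ {x s} → entry A₁ x s → Lift (inj₁ x) (inj₁ s)
    lift-other : ∀ {t} → Lift (inj₂ t) (inj₂ t)

  data FlatWire : RelOn (Node A₁ ⊎ S) where
    inner-wire : ∀ {s s'} → wire A₁ s s' → FlatWire (inj₁ s) (inj₁ s')
    outer-wire : ∀ {a b x y} → Lift a x → W a b → Lift b y → FlatWire x y

  flat : Circuit E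
  flat = circuit (Node A₁ ⊎ S) (box A₁ ⊕ G) FlatWire λ x s → ∃ λ a → J x a × Lift a s

  private
    inner-trips : Star (wire A₁ ⨟ box A₁) ⇒ λ u v → Star (FlatWire ⨟ box A₁ ⊕ G) (inj₁ u) (inj₁ v)
    inner-trips ε = ε
    inner-trips ((z , w , b) ◅ st) = (inj₁ z , inner-wire w , inj₁ b) ◅ inner-trips st

    unfold-box : ∀ {a b} → (exec A₁ ⊕ G) a b →
                 ∃₂ λ x y → Lift a x × Lift b y × Trip flat x y
    unfold-box (inj₂ g) = _ , _ , lift-other , lift-other , (_ , inj₂ g , ε)
    unfold-box (inj₁ (s , s' , j , j' , (t , b , st))) =
      inj₁ s , inj₁ s' , lift-exec j , lift-exec j' , (inj₁ t , inj₁ b , inner-trips st)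

    unfold-trips : ∀ {b b' y} → Lift b y → Star (W ⨟ exec A₁ ⊕ G) b b' →
                   ∃ λ y' → Lift b' y' × Star (FlatWire ⨟ box A₁ ⊕ G) y y'
    unfold-trips ly ε = _ , ly , ε
    unfold-trips ly ((c , w , b) ◅ st) with unfold-box b
    ... | x , y , lc , ld , (m , bm , st₁) with unfold-trips ld st
    ... | y' , ly' , st₂ = y' , ly' , ((x , outer-wire ly w lc , bm) ◅ (st₁ ◅◅ st₂))

    data Partial : E₁ ⊎ S → Node A₁ ⊎ S → Set where
      partial-exec  : ∀ {x s₀ m s} → entry A₁ x s₀ → box A₁ s₀ m → Star (wire A₁ ⨟ box A₁) m s →
                      Partial (inj₁ x) (inj₁ s)
      partial-other : ∀ {t t'} → G t t' → Partial (inj₂ t) (inj₂ t')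

    close : ∀ {a b y} → Partial a y → Lift b y → (exec A₁ ⊕ G) a b
    close (partial-exec j b st) (lift-exec j') = inj₁ (_ , _ , j , j' , (_ , b , st))
    close (partial-other g) lift-other = inj₂ g

    start : ∀ {a x w} → Lift a x → (box A₁ ⊕ G) x w → Partial a w
    start (lift-exec j) (inj₁ b) = partial-exec j b ε
    start lift-other (inj₂ g) = partial-other g

    fold-trips : ∀ {a y y' b'} → Partial a y → Star (FlatWire ⨟ box A₁ ⊕ G) y y' → Lift b' y' → Trip outer a b'
    fold-trips p ε ly = _ , close p ly , ε
    fold-trips (partial-exec j b st) ((_ , inner-wire w , inj₁ b') ◅ rest) ly =
      fold-trips (partial-exec j b (st ◅◅ ((_ , w , b') ◅ ε))) rest ly
    fold-trips p ((_ , outer-wire lb w lc , b') ◅ rest) ly with fold-trips (start lc b') rest ly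
    ... | _ , bc , st = _ , close p lb , ((_ , w , bc) ◅ st)

  flatten : exec outer ⇔ exec flat
  flatten = forth , back
    where
    forth : exec outer ⇒ exec flat
    forth (a , a' , j , j' , (b , bo , st)) with unfold-box bo
    ... | x , y , la , lb , (m , bm , st₁) with unfold-trips lb st
    ... | y' , ly' , st₂ = x , y' , (a , j , la) , (a' , j' , ly') , (m , bm , st₁ ◅◅ st₂)
    back : exec flat ⇒ exec outer
    back (x , x' , (a , j , la) , (a' , j' , la') , (m , bm , st)) =
      a , a' , j , j' , fold-trips (start la bm) st la'


-- The interpretation of a term with n free variables acts on addresses u at its root
-- (out u) or at one of its variables (at i u); a partial renaming sends the ports of
-- erased variables to the junk port dead.
data Port (n : ℕ) : Set where
  out  : Tm → Port n
  at   : Fin n → Tm → Port n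
  dead : Port n

data varNet {n} (i : Fin n) : RelOn (Port n) where
  out↦at : ∀ {u} → varNet i (out u) (at i u)
  at↦out : ∀ {u} → varNet i (at i u) (out u)

data conNet {n} (a : Rel) : RelOn (Port n) where
  con↦ : ∀ {u v} → a u v → conNet a (out u) (out v)

-- The wiring of the application f · g of 𝒫: the l-side of the function is fed to the
-- argument, the r-side is the result; free variables are shared by both boxes.
data AppWire {n} : RelOn (Port n ⊎ Port n) where
  fun↦arg : ∀ {u} → AppWire (inj₁ (out (l u))) (inj₂ (out u))
  arg↦fun : ∀ {u} → AppWire (inj₂ (out u)) (inj₁ (out (l u)))

data AppEntry {n} : Port n → Port n ⊎ Port n → Set where
  app-out : ∀ {u} → AppEntry (out u) (inj₁ (out (r u)))
  app-fun : ∀ {i u} → AppEntry (at i u) (inj₁ (at i u))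
  app-arg : ∀ {i u} → AppEntry (at i u) (inj₂ (at i u))

appCircuit : ∀ {n} → RelOn (Port n) → RelOn (Port n) → Circuit (Port n)
appCircuit R Q = circuit _ (R ⊕ Q) AppWire AppEntry

lamPort : ∀ {n} → Port (suc n) → Port n
lamPort (out u)        = out (r u)
lamPort (at zero u)    = out (l u)
lamPort (at (suc i) u) = at i u
lamPort dead           = dead

net : ∀ {n} → Λ n → RelOn (Port n)
net (var i)       = varNet i
net (con (a , _)) = conNet a
net (app M N)     = exec (appCircuit (net M) (net N))
net (lam M)       = Image lamPort (net M)

app-cong : ∀ {n} {R R' Q Q' : RelOn (Port n)} → R ⇔ R' → Q ⇔ Q' →
           exec (appCircuit R Q) ⇔ exec (appCircuit R' Q')
app-cong {R = R} {Q = Q} hR hQ = exec-cong-box (appCircuit R Q) (⊕-cong hR hQ)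

occ-var-self : ∀ {n} (i : Fin n) → occ i (var i) ≡ 1
occ-var-self i rewrite dec-true (i ≟ i) refl = refl

occ-var-≡ : ∀ {m} (k j : Fin m) → occ k (var j) ≡ 1 → k ≡ j
occ-var-≡ k j h with k ≟ j
... | yes k≡j = k≡j
occ-var-≡ k j () | no _

occ-appˡ : ∀ {n} {i : Fin n} M N → occ i (app M N) ≡ 0 → occ i M ≡ 0
occ-appˡ M _ = m+n≡0⇒m≡0 (occ _ M)

occ-appʳ : ∀ {n} {i : Fin n} M N → occ i (app M N) ≡ 0 → occ i N ≡ 0
occ-appʳ M _ = m+n≡0⇒n≡0 (occ _ M)

lamPort-at : ∀ {n} {x : Port (suc n)} {k u} → lamPort x ≡ at k u → x ≡ at (suc k) u
lamPort-at {x = out _} ()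
lamPort-at {x = at zero _} ()
lamPort-at {x = at (suc i) _} refl = refl
lamPort-at {x = dead} ()

last-box : ∀ {E} (C : Circuit E) → Trip C ⇒ λ _ s' → ∃ λ p → box C p s'
last-box C (_ , b , st) = go b st
  where
  go : ∀ {p t u} → box C p t → Star (wire C ⨟ box C) t u → ∃ λ q → box C q u
  go b ε = _ , b
  go _ ((_ , _ , b) ◅ st) = go b st

Absent : ∀ {n} → RelOn (Port n) → Fin n → Set
Absent R k = (∀ {u y} → ¬ R (at k u) y) × (∀ {u x} → ¬ R x (at k u))

net-absent : ∀ {n} (M : Λ n) k → occ k M ≡ 0 → Absent (net M) k
net-absent (var j) k h = (λ { at↦out → occ-var-self≢0 j h }) , (λ { out↦at → occ-var-self≢0 j h })
  where
  occ-var-self≢0 : ∀ i → occ i (var i) ≢ 0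
  occ-var-self≢0 i h with ≡-trans (≡-sym (occ-var-self i)) h
  ... | ()
net-absent (con a) k h = (λ ()) , (λ ())
net-absent (app A B) k h = from , to
  where
  hA : Absent (net A) k
  hA = net-absent A k (occ-appˡ A B h)
  hB : Absent (net B) k
  hB = net-absent B k (occ-appʳ A B h)
  from : ∀ {u y} → ¬ net (app A B) (at k u) y
  from (_ , _ , app-fun , _ , (_ , inj₁ a , _)) = proj₁ hA a
  from (_ , _ , app-arg , _ , (_ , inj₂ b , _)) = proj₁ hB b
  to : ∀ {u x} → ¬ net (app A B) x (at k u)
  to (_ , _ , _ , j , p) with last-box (appCircuit (net A) (net B)) p
  to (_ , _ , _ , app-fun , p) | _ , inj₁ a = proj₂ hA a
  to (_ , _ , _ , app-arg , p) | _ , inj₂ b = proj₂ hB b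
net-absent (lam M) k h = from , to
  where
  hM : Absent (net M) (suc k)
  hM = net-absent M (suc k) h
  from : ∀ {u y} → ¬ net (lam M) (at k u) y
  from (_ , _ , eq , _ , m) with lamPort-at eq
  ... | refl = proj₁ hM m
  to : ∀ {u x} → ¬ net (lam M) x (at k u)
  to (_ , _ , _ , eq , m) with lamPort-at eq
  ... | refl = proj₂ hM m

sub-ext : ∀ {m n} {σ τ : Fin m → Λ n} → (∀ i → σ i ≡ τ i) → ∀ M → sub σ M ≡ sub τ M
sub-ext h (var i)   = h i
sub-ext h (con a)   = refl
sub-ext h (app M N) = cong₂ app (sub-ext h M) (sub-ext h N)
sub-ext h (lam M)   = cong lam (sub-ext (λ { zero → refl ; (suc i) → cong (ren suc) (h i) }) M)

liftSub : ∀ {m n} → (Fin m → Λ n) → Fin (suc m) → Λ (suc n)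
liftSub σ zero    = var zero
liftSub σ (suc i) = ren suc (σ i)

sub-lam : ∀ {m n} (σ : Fin m → Λ n) M → sub σ (lam M) ≡ lam (sub (liftSub σ) M)
sub-lam σ M = cong lam (sub-ext (λ { zero → refl ; (suc i) → refl }) M)

ren≡sub : ∀ {m n} (ρ : Fin m → Fin n) M → ren ρ M ≡ sub (λ i → var (ρ i)) M
ren≡sub ρ (var i)   = refl
ren≡sub ρ (con a)   = refl
ren≡sub ρ (app M N) = cong₂ app (ren≡sub ρ M) (ren≡sub ρ N)
ren≡sub ρ (lam M)   = cong lam (≡-trans (ren≡sub _ M) (sub-ext (λ { zero → refl ; (suc i) → refl }) M))

PartialRenaming : ℕ → ℕ → Set
PartialRenaming m n = Fin m → Maybe (Fin n)

liftRen : ∀ {m n} → PartialRenaming m n → PartialRenaming (suc m) (suc n)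
liftRen ρ zero    = just zero
liftRen ρ (suc i) = Maybe.map suc (ρ i)

RenamedBy : ∀ {m n} → (Fin m → Λ n) → PartialRenaming m n → Set₁
RenamedBy σ ρ = ∀ i j → ρ i ≡ just j → σ i ≡ var j

liftSub-renamedBy : ∀ {m n} {σ : Fin m → Λ n} {ρ} → RenamedBy σ ρ → RenamedBy (liftSub σ) (liftRen ρ)
liftSub-renamedBy σ≈ρ zero .zero refl = refl
liftSub-renamedBy {ρ = ρ} σ≈ρ (suc i) j eq with ρ i in ρi
liftSub-renamedBy σ≈ρ (suc i) .(suc j) refl | just j = cong (ren suc) (σ≈ρ i j ρi)

atMaybe : ∀ {n} → Maybe (Fin n) → Tm → Port n
atMaybe nothing  u = dead
atMaybe (just j) u = at j u

renPort : ∀ {m n} → PartialRenaming m n → Port m → Port n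
renPort ρ (out u)  = out u
renPort ρ (at i u) = atMaybe (ρ i) u
renPort ρ dead     = dead

renPort-out : ∀ {m n} (ρ : PartialRenaming m n) p {u} → renPort ρ p ≡ out u → p ≡ out u
renPort-out ρ (out _) refl = refl
renPort-out ρ (at i w) h with ρ i
renPort-out ρ (at i w) () | just _
renPort-out ρ (at i w) () | nothing
renPort-out ρ dead ()

renPort-lamPort : ∀ {m n} (ρ : PartialRenaming m n) x → renPort ρ (lamPort x) ≡ lamPort (renPort (liftRen ρ) x)
renPort-lamPort ρ (out u) = refl
renPort-lamPort ρ (at zero u) = refl
renPort-lamPort ρ (at (suc i) u) with ρ i
... | just j  = refl
... | nothing = refl
renPort-lamPort ρ dead = refl

-- Renaming commutes with application; variables erased by ρ have no ports in A or B, so the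
-- junk port dead is never reached.
module _ {m n} (ρ : PartialRenaming m n) (A B : RelOn (Port m))
         (absentA : ∀ i → ρ i ≡ nothing → Absent A i)
         (absentB : ∀ i → ρ i ≡ nothing → Absent B i) where

  private
    θ : Port m ⊎ Port m → Port n ⊎ Port n
    θ = Sum.map (renPort ρ) (renPort ρ)

    Entry : Port n → Port m ⊎ Port m → Set
    Entry x s = ∃ λ x₀ → renPort ρ x₀ ≡ x × AppEntry x₀ s

    box-reflect : ∀ {x y} → (Image (renPort ρ) A ⊕ Image (renPort ρ) B) x y →
                  ∃₂ λ s t → θ s ≡ x × θ t ≡ y × (A ⊕ B) s t
    box-reflect (inj₁ (x , y , refl , refl , a)) = inj₁ x , inj₁ y , refl , refl , inj₁ a
    box-reflect (inj₂ (x , y , refl , refl , b)) = inj₂ x , inj₂ y , refl , refl , inj₂ b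

    wire-pullback : ∀ t {z} → AppWire (θ t) z → ∃ λ s' → AppWire t s' × θ s' ≡ z
    wire-pullback (inj₁ (out _)) fun↦arg = _ , fun↦arg , refl
    wire-pullback (inj₂ (out _)) arg↦fun = _ , arg↦fun , refl
    wire-pullback (inj₁ (at i w)) h with ρ i
    wire-pullback (inj₁ (at i w)) () | just _
    wire-pullback (inj₁ (at i w)) () | nothing
    wire-pullback (inj₂ (at i w)) h with ρ i
    wire-pullback (inj₂ (at i w)) () | just _
    wire-pullback (inj₂ (at i w)) () | nothing

    wire-injective : ∀ {t s'} s'' → AppWire t s' → θ s'' ≡ θ s' → s'' ≡ s'
    wire-injective (inj₁ p) arg↦fun eq = cong inj₁ (renPort-out ρ p (inj₁-injective eq))
    wire-injective (inj₂ p) fun↦arg eq = cong inj₂ (renPort-out ρ p (inj₂-injective eq))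

    entry-preserve : ∀ {x s} → Entry x s → Endpoint (circuit _ (A ⊕ B) AppWire Entry) s → AppEntry x (θ s)
    entry-preserve (_ , refl , app-out) b = app-out
    entry-preserve (at i u , refl , app-fun) b with ρ i in ρi
    ... | just j = app-fun
    entry-preserve (at i u , refl , app-fun) (_ , inj₁ (inj₁ a)) | nothing = ⊥-elim (proj₁ (absentA i ρi) a)
    entry-preserve (at i u , refl , app-fun) (_ , inj₂ (inj₁ a)) | nothing = ⊥-elim (proj₂ (absentA i ρi) a)
    entry-preserve (at i u , refl , app-arg) b with ρ i in ρi
    ... | just j = app-arg
    entry-preserve (at i u , refl , app-arg) (_ , inj₁ (inj₂ b)) | nothing = ⊥-elim (proj₁ (absentB i ρi) b)
    entry-preserve (at i u , refl , app-arg) (_ , inj₂ (inj₂ b)) | nothing = ⊥-elim (proj₂ (absentB i ρi) b)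

    entry-reflect : ∀ {x} s → AppEntry x (θ s) → Entry x s
    entry-reflect (inj₁ (out _)) app-out = _ , refl , app-out
    entry-reflect (inj₁ (at i w)) h with ρ i in ρi
    entry-reflect (inj₁ (at i w)) app-fun | just j = at i w , cong (λ m → atMaybe m w) ρi , app-fun
    entry-reflect (inj₂ (at i w)) h with ρ i in ρi
    entry-reflect (inj₂ (at i w)) app-arg | just j = at i w , cong (λ m → atMaybe m w) ρi , app-arg

  rename-app-morphism : CircuitMorphism (circuit _ (A ⊕ B) AppWire Entry)
                                        (appCircuit (Image (renPort ρ) A) (Image (renPort ρ) B))
  rename-app-morphism = record
    { node            = θ
    ; box-preserve    = λ { (inj₁ a) → inj₁ (_ , _ , refl , refl , a) ; (inj₂ b) → inj₂ (_ , _ , refl , refl , b) }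
    ; box-reflect     = box-reflect
    ; wire-preserve   = λ { _ fun↦arg _ → fun↦arg ; _ arg↦fun _ → arg↦fun }
    ; wire-reflect    = wire-reflect-from {W = AppWire} {W' = AppWire} θ box-reflect
                          (λ {t = t} _ w → wire-pullback t w) (λ {s'' = s''} w _ eq → wire-injective s'' w eq)
    ; entry-preserve  = entry-preserve
    ; entry-reflect   = λ {s = s} j _ → entry-reflect s j
    }

net-rename : ∀ {m n} (M : Λ m) (σ : Fin m → Λ n) (ρ : PartialRenaming m n) → RenamedBy σ ρ →
             (∀ i → ρ i ≡ nothing → occ i M ≡ 0) → net (sub σ M) ⇔ Image (renPort ρ) (net M)
net-rename (var i) σ ρ σ≈ρ unused with ρ i in ρi
... | nothing with ≡-trans (≡-sym (occ-var-self i)) (unused i ρi)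
... | ()
net-rename (var i) σ ρ σ≈ρ unused | just j rewrite σ≈ρ i j ρi = forth , back
  where
  forth : varNet j ⇒ Image (renPort ρ) (varNet i)
  forth (out↦at {u}) = out u , at i u , refl , cong (λ m → atMaybe m u) ρi , out↦at
  forth (at↦out {u}) = at i u , out u , cong (λ m → atMaybe m u) ρi , refl , at↦out
  back : Image (renPort ρ) (varNet i) ⇒ varNet j
  back (out u , at .i .u , refl , eq , out↦at) rewrite ρi with eq
  ... | refl = out↦at
  back (at .i u , out .u , eq , refl , at↦out) rewrite ρi with eq
  ... | refl = at↦out
net-rename (con (a , _)) σ ρ σ≈ρ unused =
  (λ { (con↦ h) → _ , _ , refl , refl , con↦ h }) , (λ { (_ , _ , refl , refl , con↦ h) → con↦ h })
net-rename (app A B) σ ρ σ≈ρ unused =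
  ⇔-trans (app-cong (net-rename A σ ρ σ≈ρ unusedA) (net-rename B σ ρ σ≈ρ unusedB))
  (⇔-trans (⇔-sym (exec-invariant (rename-app-morphism ρ (net A) (net B) absentA absentB)))
           (⇔-sym (image-exec (renPort ρ) (appCircuit (net A) (net B)))))
  where
  unusedA : ∀ i → ρ i ≡ nothing → occ i A ≡ 0
  unusedA i eq = occ-appˡ A B (unused i eq)
  unusedB : ∀ i → ρ i ≡ nothing → occ i B ≡ 0
  unusedB i eq = occ-appʳ A B (unused i eq)
  absentA : ∀ i → ρ i ≡ nothing → Absent (net A) i
  absentA i eq = net-absent A i (unusedA i eq)
  absentB : ∀ i → ρ i ≡ nothing → Absent (net B) i
  absentB i eq = net-absent B i (unusedB i eq)
net-rename (lam M) σ ρ σ≈ρ unused =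
  ⇔-trans (≡⇒⇔ (cong net (sub-lam σ M)))
  (⇔-trans (image-cong lamPort (net-rename M (liftSub σ) (liftRen ρ) (liftSub-renamedBy σ≈ρ) unused′))
  (⇔-trans (image-∘ (renPort (liftRen ρ)) lamPort _ (λ _ → refl))
           (⇔-sym (image-∘ lamPort (renPort ρ) _ (renPort-lamPort ρ)))))
  where
  unused′ : ∀ i → liftRen ρ i ≡ nothing → occ i M ≡ 0
  unused′ (suc i) eq with ρ i in ρi
  unused′ (suc i) refl | nothing = unused i ρi

net-ren : ∀ {m n} (ρ : Fin m → Fin n) M → net (ren ρ M) ⇔ Image (renPort (λ i → just (ρ i))) (net M)
net-ren ρ M rewrite ren≡sub ρ M = net-rename M _ _ (λ { i j refl → refl }) (λ i ())

-- Plugging Q into the variable k of R; the other variables of R are renamed by ρ.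
data SubWire {m n} (k : Fin m) : RelOn (Port m ⊎ Port n) where
  var↦arg : ∀ {u} → SubWire k (inj₁ (at k u)) (inj₂ (out u))
  arg↦var : ∀ {u} → SubWire k (inj₂ (out u)) (inj₁ (at k u))

data SubEntry {m n} (ρ : PartialRenaming m n) : Port n → Port m ⊎ Port n → Set where
  sub-out  : ∀ {u} → SubEntry ρ (out u) (inj₁ (out u))
  sub-body : ∀ {i j u} → ρ i ≡ just j → SubEntry ρ (at j u) (inj₁ (at i u))
  sub-arg  : ∀ {j u} → SubEntry ρ (at j u) (inj₂ (at j u))

substCircuit : ∀ {m n} → Fin m → PartialRenaming m n → RelOn (Port m) → RelOn (Port n) → Circuit (Port n)
substCircuit k ρ R Q = circuit _ (R ⊕ Q) (SubWire k) (SubEntry ρ)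

NoDead : ∀ {n} → RelOn (Port n) → Set
NoDead R = (∀ {y} → ¬ R dead y) × (∀ {x} → ¬ R x dead)

lamPort-dead : ∀ {n} {x : Port (suc n)} → lamPort x ≡ dead → x ≡ dead
lamPort-dead {x = out _} ()
lamPort-dead {x = at zero _} ()
lamPort-dead {x = at (suc _) _} ()
lamPort-dead {x = dead} refl = refl

net-noDead : ∀ {n} (M : Λ n) → NoDead (net M)
net-noDead (var i)   = (λ ()) , (λ ())
net-noDead (con a)   = (λ ()) , (λ ())
net-noDead (app A B) = (λ { (_ , _ , () , _) }) , (λ { (_ , _ , _ , () , _) })
net-noDead (lam M)   = (λ { (_ , _ , eq , _ , m) → from (lamPort-dead eq) m })
                     , (λ { (_ , _ , _ , eq , m) → to (lamPort-dead eq) m })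
  where
  from : ∀ {x y} → x ≡ dead → ¬ net M x y
  from refl = proj₁ (net-noDead M)
  to : ∀ {x y} → y ≡ dead → ¬ net M x y
  to refl = proj₂ (net-noDead M)

subst-var : ∀ {m n} (k : Fin m) (ρ : PartialRenaming m n) (Q : RelOn (Port n)) → ρ k ≡ nothing →
            NoDead Q → Q ⇔ exec (substCircuit k ρ (varNet k) Q)
subst-var {n = n} k ρ Q ρk (noDeadˡ , noDeadʳ) = forth , back
  where
  C : Circuit (Port n)
  C = substCircuit k ρ (varNet k) Q

  ρk≢just : ∀ {j} → ρ k ≢ just j
  ρk≢just h with ≡-trans (≡-sym ρk) h
  ... | ()

  after-arg : ∀ {x y y₁ s'} → Q x y₁ → Star (wire C ⨟ box C) (inj₂ y₁) s' → SubEntry ρ y s' → Q x y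
  after-arg q ε sub-arg = q
  after-arg q ((_ , arg↦var , inj₁ at↦out) ◅ ε) sub-out = q
  after-arg q ((_ , arg↦var , inj₁ at↦out) ◅ ((_ , () , _) ◅ _)) _

  after-var : ∀ {u y s'} → Star (wire C ⨟ box C) (inj₁ (at k u)) s' → SubEntry ρ y s' → Q (out u) y
  after-var ε (sub-body h) = ⊥-elim (ρk≢just h)
  after-var ((_ , var↦arg , inj₂ q) ◅ st) j = after-arg q st j

  forth : Q ⇒ exec C
  forth {out u} {out v} q = _ , _ , sub-out , sub-out ,
    (inj₁ (at k u) , inj₁ out↦at , ((_ , var↦arg , inj₂ q) ◅ ((_ , arg↦var , inj₁ at↦out) ◅ ε)))
  forth {out u} {at j v} q =
    _ , _ , sub-out , sub-arg , (inj₁ (at k u) , inj₁ out↦at , ((_ , var↦arg , inj₂ q) ◅ ε))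
  forth {at j u} {out v} q = _ , _ , sub-arg , sub-out , (_ , inj₂ q , ((_ , arg↦var , inj₁ at↦out) ◅ ε))
  forth {at j u} {at j' v} q = _ , _ , sub-arg , sub-arg , (_ , inj₂ q , ε)
  forth {dead} q = ⊥-elim (noDeadˡ q)
  forth {out _} {dead} q = ⊥-elim (noDeadʳ q)
  forth {at _ _} {dead} q = ⊥-elim (noDeadʳ q)

  back : exec C ⇒ Q
  back (_ , _ , sub-out , j , (_ , inj₁ out↦at , st)) = after-var st j
  back (_ , _ , sub-body h , _ , (_ , inj₁ at↦out , _)) = ⊥-elim (ρk≢just h)
  back (_ , _ , sub-arg , j , (_ , inj₂ q , st)) = after-arg q st j

-- When the substituted variable occurs in the function A of an application A B, substituting
-- into the application and applying the substituted function both flatten to a circuit with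
-- boxes A, B and N, and the two flat circuits are identified by a morphism.
module SubstFun {m n} (k : Fin m) (ρ : PartialRenaming m n) (A B : RelOn (Port m)) (N : RelOn (Port n))
                (ρk : ρ k ≡ nothing) (absentB : ∀ i → ρ i ≡ nothing → Absent B i) where

  module AppOfSub = Flatten (substCircuit k ρ A N) (Image (renPort ρ) B) AppWire AppEntry
  module SubOfApp = Flatten (appCircuit A B) N (SubWire k) (SubEntry ρ)
  open AppOfSub using (inner-wire; outer-wire; lift-exec; lift-other)
  open SubOfApp using () renaming (inner-wire to inner-wire′; outer-wire to outer-wire′;
                                   lift-exec to lift-exec′; lift-other to lift-other′)

  private
    θ : (Port m ⊎ Port m) ⊎ Port n → (Port m ⊎ Port n) ⊎ Port n
    θ (inj₁ (inj₁ p)) = inj₁ (inj₁ p)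
    θ (inj₁ (inj₂ p)) = inj₂ (renPort ρ p)
    θ (inj₂ q)        = inj₁ (inj₂ q)

    box-preserve : ∀ {s t} → box SubOfApp.flat s t → box AppOfSub.flat (θ s) (θ t)
    box-preserve (inj₁ (inj₁ a)) = inj₁ (inj₁ a)
    box-preserve (inj₁ (inj₂ b)) = inj₂ (_ , _ , refl , refl , b)
    box-preserve (inj₂ q)        = inj₁ (inj₂ q)

    box-reflect : ∀ {x y} → box AppOfSub.flat x y → ∃₂ λ s t → θ s ≡ x × θ t ≡ y × box SubOfApp.flat s t
    box-reflect (inj₁ (inj₁ a)) = _ , _ , refl , refl , inj₁ (inj₁ a)
    box-reflect (inj₁ (inj₂ q)) = inj₂ _ , inj₂ _ , refl , refl , inj₂ q
    box-reflect (inj₂ (x , y , refl , refl , b)) = inj₁ (inj₂ x) , inj₁ (inj₂ y) , refl , refl , inj₁ (inj₂ b)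

    wire-preserve : ∀ {s t s' t'} → box SubOfApp.flat s t → wire SubOfApp.flat t s' → box SubOfApp.flat s' t' →
                    wire AppOfSub.flat (θ t) (θ s')
    wire-preserve _ (inner-wire′ fun↦arg) _ = outer-wire (lift-exec sub-out) fun↦arg lift-other
    wire-preserve _ (inner-wire′ arg↦fun) _ = outer-wire lift-other arg↦fun (lift-exec sub-out)
    wire-preserve _ (outer-wire′ (lift-exec′ app-fun) var↦arg lift-other′) _ = inner-wire var↦arg
    wire-preserve (inj₁ (inj₂ b)) (outer-wire′ (lift-exec′ app-arg) var↦arg lift-other′) _ =
      ⊥-elim (proj₂ (absentB k ρk) b)
    wire-preserve _ (outer-wire′ lift-other′ arg↦var (lift-exec′ app-fun)) _ = inner-wire arg↦var
    wire-preserve _ (outer-wire′ lift-other′ arg↦var (lift-exec′ app-arg)) (inj₁ (inj₂ b)) =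
      ⊥-elim (proj₁ (absentB k ρk) b)

    wire-reflect : ∀ t {z w} → wire AppOfSub.flat (θ t) z → box AppOfSub.flat z w →
                   ∃₂ λ s' t' → wire SubOfApp.flat t s' × box SubOfApp.flat s' t' × θ s' ≡ z × θ t' ≡ w
    wire-reflect (inj₁ (inj₁ _)) (inner-wire var↦arg) (inj₁ (inj₂ q)) =
      inj₂ _ , inj₂ _ , outer-wire′ (lift-exec′ app-fun) var↦arg lift-other′ , inj₂ q , refl , refl
    wire-reflect (inj₁ (inj₁ _)) (outer-wire (lift-exec sub-out) fun↦arg lift-other) (inj₂ (x , y , eq , refl , b))
      with renPort-out ρ x eq
    ... | refl = inj₁ (inj₂ _) , inj₁ (inj₂ y) , inner-wire′ fun↦arg , inj₁ (inj₂ b) , refl , refl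
    wire-reflect (inj₁ (inj₂ (out w))) (outer-wire lift-other arg↦fun (lift-exec sub-out)) (inj₁ (inj₁ a)) =
      inj₁ (inj₁ _) , inj₁ (inj₁ _) , inner-wire′ arg↦fun , inj₁ (inj₁ a) , refl , refl
    wire-reflect (inj₁ (inj₂ (at i w))) h b with ρ i
    wire-reflect (inj₁ (inj₂ (at i w))) (outer-wire lift-other () _) b | just _
    wire-reflect (inj₁ (inj₂ (at i w))) (outer-wire lift-other () _) b | nothing
    wire-reflect (inj₁ (inj₂ dead)) (outer-wire lift-other () _) b
    wire-reflect (inj₂ _) (inner-wire arg↦var) (inj₁ (inj₁ a)) =
      inj₁ (inj₁ _) , inj₁ (inj₁ _) , outer-wire′ lift-other′ arg↦var (lift-exec′ app-fun) , inj₁ (inj₁ a) ,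
      refl , refl
    wire-reflect (inj₂ _) (outer-wire (lift-exec sub-arg) () _) b

    entry-preserve : ∀ {x s} → entry SubOfApp.flat x s → entry AppOfSub.flat x (θ s)
    entry-preserve (inj₁ (out u) , sub-out , lift-exec′ app-out) = inj₁ (out (r u)) , app-out , lift-exec sub-out
    entry-preserve (inj₁ (at i u) , sub-body h , lift-exec′ app-fun) = inj₁ _ , app-fun , lift-exec (sub-body h)
    entry-preserve (inj₁ (at i u) , sub-body h , lift-exec′ app-arg) rewrite h = inj₂ _ , app-arg , lift-other
    entry-preserve (inj₂ _ , sub-arg , lift-other′) = inj₁ _ , app-fun , lift-exec sub-arg

    entry-reflect : ∀ {x} s → entry AppOfSub.flat x (θ s) → entry SubOfApp.flat x s
    entry-reflect (inj₁ (inj₁ _)) (inj₁ _ , app-out , lift-exec sub-out) = inj₁ _ , sub-out , lift-exec′ app-out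
    entry-reflect (inj₁ (inj₁ _)) (inj₁ _ , app-fun , lift-exec (sub-body h)) =
      inj₁ _ , sub-body h , lift-exec′ app-fun
    entry-reflect (inj₁ (inj₂ (out w))) (inj₂ _ , () , lift-other)
    entry-reflect (inj₁ (inj₂ (at i w))) h with ρ i in ρi
    entry-reflect (inj₁ (inj₂ (at i w))) (inj₂ _ , app-arg , lift-other) | just j =
      inj₁ _ , sub-body ρi , lift-exec′ app-arg
    entry-reflect (inj₁ (inj₂ (at i w))) (inj₂ _ , () , lift-other) | nothing
    entry-reflect (inj₁ (inj₂ dead)) (inj₂ _ , () , lift-other)
    entry-reflect (inj₂ _) (inj₁ _ , app-fun , lift-exec sub-arg) = inj₂ _ , sub-arg , lift-other′

  morphism : CircuitMorphism SubOfApp.flat AppOfSub.flat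
  morphism = record
    { node = θ ; box-preserve = box-preserve ; box-reflect = box-reflect ; wire-preserve = wire-preserve
    ; wire-reflect = λ {t = t} _ w b → wire-reflect t w b
    ; entry-preserve = λ j _ → entry-preserve j
    ; entry-reflect = λ {s = s} j _ → entry-reflect s j }

data AppWireᵒᵖ {n} : RelOn (Port n ⊎ Port n) where
  fun↦argᵒᵖ : ∀ {u} → AppWireᵒᵖ (inj₂ (out (l u))) (inj₁ (out u))
  arg↦funᵒᵖ : ∀ {u} → AppWireᵒᵖ (inj₁ (out u)) (inj₂ (out (l u)))

data AppEntryᵒᵖ {n} : Port n → Port n ⊎ Port n → Set where
  app-outᵒᵖ : ∀ {u} → AppEntryᵒᵖ (out u) (inj₂ (out (r u)))
  app-funᵒᵖ : ∀ {i u} → AppEntryᵒᵖ (at i u) (inj₂ (at i u))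
  app-argᵒᵖ : ∀ {i u} → AppEntryᵒᵖ (at i u) (inj₁ (at i u))

appCircuitᵒᵖ : ∀ {n} → RelOn (Port n) → RelOn (Port n) → Circuit (Port n)
appCircuitᵒᵖ Q R = circuit _ (Q ⊕ R) AppWireᵒᵖ AppEntryᵒᵖ

app-mirror : ∀ {n} (R Q : RelOn (Port n)) → CircuitMorphism (appCircuit R Q) (appCircuitᵒᵖ Q R)
app-mirror R Q = record
  { node           = Sum.swap
  ; box-preserve   = λ { (inj₁ a) → inj₂ a ; (inj₂ b) → inj₁ b }
  ; box-reflect    = λ { (inj₁ b) → inj₂ _ , inj₂ _ , refl , refl , inj₂ b
                       ; (inj₂ a) → inj₁ _ , inj₁ _ , refl , refl , inj₁ a }
  ; wire-preserve  = λ { _ fun↦arg _ → fun↦argᵒᵖ ; _ arg↦fun _ → arg↦funᵒᵖ }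
  ; wire-reflect   = λ { (inj₁ _) fun↦argᵒᵖ (inj₁ b) → _ , _ , fun↦arg , inj₂ b , refl , refl
                       ; (inj₂ _) arg↦funᵒᵖ (inj₂ a) → _ , _ , arg↦fun , inj₁ a , refl , refl }
  ; entry-preserve = λ { app-out _ → app-outᵒᵖ ; app-fun _ → app-funᵒᵖ ; app-arg _ → app-argᵒᵖ }
  ; entry-reflect  = λ { {s = inj₁ _} app-outᵒᵖ _ → app-out ; {s = inj₁ _} app-funᵒᵖ _ → app-fun
                       ; {s = inj₂ _} app-argᵒᵖ _ → app-arg }
  }

-- When the substituted variable occurs in the argument B, the argument box is moved to the
-- left first, so that the nested execution can again be flattened by Flatten.
module SubstArg {m n} (k : Fin m) (ρ : PartialRenaming m n) (A B : RelOn (Port m)) (N : RelOn (Port n))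
                (ρk : ρ k ≡ nothing) (absentA : ∀ i → ρ i ≡ nothing → Absent A i) where

  module AppOfSub = Flatten (substCircuit k ρ B N) (Image (renPort ρ) A) AppWireᵒᵖ AppEntryᵒᵖ
  module SubOfApp = Flatten (appCircuit A B) N (SubWire k) (SubEntry ρ)
  open AppOfSub using (inner-wire; outer-wire; lift-exec; lift-other)
  open SubOfApp using () renaming (inner-wire to inner-wire′; outer-wire to outer-wire′;
                                   lift-exec to lift-exec′; lift-other to lift-other′)

  private
    θ : (Port m ⊎ Port m) ⊎ Port n → (Port m ⊎ Port n) ⊎ Port n
    θ (inj₁ (inj₁ p)) = inj₂ (renPort ρ p)
    θ (inj₁ (inj₂ p)) = inj₁ (inj₁ p)
    θ (inj₂ q)        = inj₁ (inj₂ q)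

    box-preserve : ∀ {s t} → box SubOfApp.flat s t → box AppOfSub.flat (θ s) (θ t)
    box-preserve (inj₁ (inj₁ a)) = inj₂ (_ , _ , refl , refl , a)
    box-preserve (inj₁ (inj₂ b)) = inj₁ (inj₁ b)
    box-preserve (inj₂ q)        = inj₁ (inj₂ q)

    box-reflect : ∀ {x y} → box AppOfSub.flat x y → ∃₂ λ s t → θ s ≡ x × θ t ≡ y × box SubOfApp.flat s t
    box-reflect (inj₁ (inj₁ b)) = inj₁ (inj₂ _) , inj₁ (inj₂ _) , refl , refl , inj₁ (inj₂ b)
    box-reflect (inj₁ (inj₂ q)) = inj₂ _ , inj₂ _ , refl , refl , inj₂ q
    box-reflect (inj₂ (x , y , refl , refl , a)) = inj₁ (inj₁ x) , inj₁ (inj₁ y) , refl , refl , inj₁ (inj₁ a)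

    wire-preserve : ∀ {s t s' t'} → box SubOfApp.flat s t → wire SubOfApp.flat t s' → box SubOfApp.flat s' t' →
                    wire AppOfSub.flat (θ t) (θ s')
    wire-preserve _ (inner-wire′ fun↦arg) _ = outer-wire lift-other fun↦argᵒᵖ (lift-exec sub-out)
    wire-preserve _ (inner-wire′ arg↦fun) _ = outer-wire (lift-exec sub-out) arg↦funᵒᵖ lift-other
    wire-preserve _ (outer-wire′ (lift-exec′ app-arg) var↦arg lift-other′) _ = inner-wire var↦arg
    wire-preserve (inj₁ (inj₁ a)) (outer-wire′ (lift-exec′ app-fun) var↦arg lift-other′) _ =
      ⊥-elim (proj₂ (absentA k ρk) a)
    wire-preserve _ (outer-wire′ lift-other′ arg↦var (lift-exec′ app-arg)) _ = inner-wire arg↦var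
    wire-preserve _ (outer-wire′ lift-other′ arg↦var (lift-exec′ app-fun)) (inj₁ (inj₁ a)) =
      ⊥-elim (proj₁ (absentA k ρk) a)

    wire-reflect : ∀ t {z w} → wire AppOfSub.flat (θ t) z → box AppOfSub.flat z w →
                   ∃₂ λ s' t' → wire SubOfApp.flat t s' × box SubOfApp.flat s' t' × θ s' ≡ z × θ t' ≡ w
    wire-reflect (inj₁ (inj₁ (out _))) (outer-wire lift-other fun↦argᵒᵖ (lift-exec sub-out)) (inj₁ (inj₁ b)) =
      inj₁ (inj₂ _) , inj₁ (inj₂ _) , inner-wire′ fun↦arg , inj₁ (inj₂ b) , refl , refl
    wire-reflect (inj₁ (inj₁ (at i w))) h b with ρ i
    wire-reflect (inj₁ (inj₁ (at i w))) (outer-wire lift-other () _) b | just _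
    wire-reflect (inj₁ (inj₁ (at i w))) (outer-wire lift-other () _) b | nothing
    wire-reflect (inj₁ (inj₁ dead)) (outer-wire lift-other () _) b
    wire-reflect (inj₁ (inj₂ _)) (inner-wire var↦arg) (inj₁ (inj₂ q)) =
      inj₂ _ , inj₂ _ , outer-wire′ (lift-exec′ app-arg) var↦arg lift-other′ , inj₂ q , refl , refl
    wire-reflect (inj₁ (inj₂ _)) (outer-wire (lift-exec sub-out) arg↦funᵒᵖ lift-other) (inj₂ (x , y , eq , refl , a))
      with renPort-out ρ x eq
    ... | refl = inj₁ (inj₁ _) , inj₁ (inj₁ y) , inner-wire′ arg↦fun , inj₁ (inj₁ a) , refl , refl
    wire-reflect (inj₁ (inj₂ _)) (outer-wire (lift-exec (sub-body _)) () _) b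
    wire-reflect (inj₂ _) (inner-wire arg↦var) (inj₁ (inj₁ b)) =
      inj₁ (inj₂ _) , inj₁ (inj₂ _) , outer-wire′ lift-other′ arg↦var (lift-exec′ app-arg) , inj₁ (inj₂ b) ,
      refl , refl
    wire-reflect (inj₂ _) (outer-wire (lift-exec sub-arg) () _) b

    entry-preserve : ∀ {x s} → entry SubOfApp.flat x s → entry AppOfSub.flat x (θ s)
    entry-preserve (inj₁ (out u) , sub-out , lift-exec′ app-out) = inj₂ (out (r u)) , app-outᵒᵖ , lift-other
    entry-preserve (inj₁ (at i u) , sub-body h , lift-exec′ app-fun) rewrite h = inj₂ _ , app-funᵒᵖ , lift-other
    entry-preserve (inj₁ (at i u) , sub-body h , lift-exec′ app-arg) = inj₁ _ , app-argᵒᵖ , lift-exec (sub-body h)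
    entry-preserve (inj₂ _ , sub-arg , lift-other′) = inj₁ _ , app-argᵒᵖ , lift-exec sub-arg

    entry-reflect : ∀ {x} s → entry AppOfSub.flat x (θ s) → entry SubOfApp.flat x s
    entry-reflect (inj₁ (inj₁ (out w))) (inj₂ _ , app-outᵒᵖ , lift-other) = inj₁ _ , sub-out , lift-exec′ app-out
    entry-reflect (inj₁ (inj₁ (at i w))) h with ρ i in ρi
    entry-reflect (inj₁ (inj₁ (at i w))) (inj₂ _ , app-funᵒᵖ , lift-other) | just j =
      inj₁ _ , sub-body ρi , lift-exec′ app-fun
    entry-reflect (inj₁ (inj₁ (at i w))) (inj₂ _ , () , lift-other) | nothing
    entry-reflect (inj₁ (inj₁ dead)) (inj₂ _ , () , lift-other)
    entry-reflect (inj₁ (inj₂ _)) (inj₁ _ , app-argᵒᵖ , lift-exec (sub-body h)) =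
      inj₁ _ , sub-body h , lift-exec′ app-arg
    entry-reflect (inj₂ _) (inj₁ _ , app-argᵒᵖ , lift-exec sub-arg) = inj₂ _ , sub-arg , lift-other′

  morphism : CircuitMorphism SubOfApp.flat AppOfSub.flat
  morphism = record
    { node = θ ; box-preserve = box-preserve ; box-reflect = box-reflect ; wire-preserve = wire-preserve
    ; wire-reflect = λ {t = t} _ w b → wire-reflect t w b
    ; entry-preserve = λ j _ → entry-preserve j
    ; entry-reflect = λ {s = s} j _ → entry-reflect s j }

shiftPort : ∀ {n} → Port n → Port (suc n)
shiftPort = renPort (λ i → just (suc i))

unshiftPort : ∀ {n} → Port (suc n) → Port n
unshiftPort (out u)        = out u
unshiftPort (at zero u)    = dead
unshiftPort (at (suc j) u) = at j u
unshiftPort dead           = dead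

unshift-shift : ∀ {n} (q : Port n) → unshiftPort (shiftPort q) ≡ q
unshift-shift (out u)  = refl
unshift-shift (at j u) = refl
unshift-shift dead     = refl

shiftPort≢at-zero : ∀ {n} (q : Port n) {u} → shiftPort q ≢ at zero u
shiftPort≢at-zero (out _) ()
shiftPort≢at-zero (at _ _) ()
shiftPort≢at-zero dead ()

map-suc≢just-zero : ∀ {n} (x : Maybe (Fin n)) → Maybe.map (Fin.suc {n}) x ≢ just zero
map-suc≢just-zero (just _) ()
map-suc≢just-zero nothing ()

-- Under a binder the plugged net is shifted past the new variable zero, which it does not use.
module _ {m n} (k : Fin m) (ρ : PartialRenaming m n) (R : RelOn (Port (suc m))) (Q : RelOn (Port n)) where

  private
    Entry : Port n → Port (suc m) ⊎ Port (suc n) → Set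
    Entry x s = ∃ λ x₀ → lamPort x₀ ≡ x × SubEntry (liftRen ρ) x₀ s

    Source : Circuit (Port n)
    Source = circuit _ (R ⊕ Image shiftPort Q) (SubWire (suc k)) Entry

    θ : Port (suc m) ⊎ Port (suc n) → Port m ⊎ Port n
    θ (inj₁ p) = inj₁ (lamPort p)
    θ (inj₂ q) = inj₂ (unshiftPort q)

    box-preserve : ∀ {s t} → box Source s t → (Image lamPort R ⊕ Q) (θ s) (θ t)
    box-preserve (inj₁ a) = inj₁ (_ , _ , refl , refl , a)
    box-preserve (inj₂ (x , y , refl , refl , q)) rewrite unshift-shift x | unshift-shift y = inj₂ q

    box-reflect : ∀ {x y} → (Image lamPort R ⊕ Q) x y → ∃₂ λ s t → θ s ≡ x × θ t ≡ y × box Source s t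
    box-reflect (inj₁ (x , y , refl , refl , a)) = inj₁ x , inj₁ y , refl , refl , inj₁ a
    box-reflect (inj₂ {x} {y} q) =
      inj₂ (shiftPort x) , inj₂ (shiftPort y) , cong inj₂ (unshift-shift x) , cong inj₂ (unshift-shift y) ,
      inj₂ (x , y , refl , refl , q)

    wire-reflect : ∀ t {z w} → SubWire k (θ t) z → (Image lamPort R ⊕ Q) z w →
                   ∃₂ λ s' t' → SubWire (suc k) t s' × box Source s' t' × θ s' ≡ z × θ t' ≡ w
    wire-reflect (inj₁ (at (suc i) w)) var↦arg (inj₂ {d = y} q) =
      inj₂ (out w) , inj₂ (shiftPort y) , var↦arg , inj₂ (_ , _ , refl , refl , q) ,
      refl , cong inj₂ (unshift-shift y)
    wire-reflect (inj₂ (out w)) arg↦var (inj₁ (x , y , eq , refl , a)) with lamPort-at eq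
    ... | refl = inj₁ _ , inj₁ y , arg↦var , inj₁ a , refl , refl
    wire-reflect (inj₂ (at zero _)) () b
    wire-reflect (inj₂ (at (suc _) _)) () b

    entry-preserve : ∀ {x s} → Entry x s → Endpoint Source s → SubEntry ρ x (θ s)
    entry-preserve (out u , refl , sub-out) _ = sub-out
    entry-preserve (at zero u , refl , sub-body {zero} h) _ = sub-out
    entry-preserve (at zero u , refl , sub-body {suc i} h) _ = ⊥-elim (map-suc≢just-zero (ρ i) h)
    entry-preserve (at (suc j) u , refl , sub-body {suc i} h) _ = sub-body (map-injective suc-injective h)
    entry-preserve (at zero u , refl , sub-arg) (_ , inj₁ (inj₂ (x , _ , eq , _ , _))) =
      ⊥-elim (shiftPort≢at-zero x eq)
    entry-preserve (at zero u , refl , sub-arg) (_ , inj₂ (inj₂ (_ , y , _ , eq , _))) =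
      ⊥-elim (shiftPort≢at-zero y eq)
    entry-preserve (at (suc j) u , refl , sub-arg) _ = sub-arg

    entry-reflect : ∀ {x} s → SubEntry ρ x (θ s) → Entry x s
    entry-reflect (inj₁ (out w)) sub-out = out w , refl , sub-out
    entry-reflect (inj₁ (at zero w)) sub-out = at zero w , refl , sub-body {i = zero} refl
    entry-reflect (inj₁ (at (suc i) w)) (sub-body {j = j} h) = at (suc j) w , refl , sub-body (map-just h)
    entry-reflect (inj₂ (at (suc j) w)) sub-arg = at (suc j) w , refl , sub-arg

  subst-lam-morphism : CircuitMorphism Source (substCircuit k ρ (Image lamPort R) Q)
  subst-lam-morphism = record
    { node = θ ; box-preserve = box-preserve ; box-reflect = box-reflect
    ; wire-preserve = λ { _ var↦arg _ → var↦arg ; _ arg↦var _ → arg↦var }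
    ; wire-reflect = λ {t = t} _ w b → wire-reflect t w b
    ; entry-preserve = entry-preserve
    ; entry-reflect = λ {s = s} j _ → entry-reflect s j }

m+n≡1-cases : ∀ a b → a + b ≡ 1 → (a ≡ 1 × b ≡ 0) ⊎ (a ≡ 0 × b ≡ 1)
m+n≡1-cases zero (suc zero) refl = inj₂ (refl , refl)
m+n≡1-cases (suc zero) zero refl = inj₁ (refl , refl)

-- σ acts as a partial renaming on the variables other than k; this generality is what lets the
-- induction go under binders and into the subterm not containing k.
net-subst : ∀ {m n} (M : Λ m) (σ : Fin m → Λ n) (k : Fin m) (ρ : PartialRenaming m n) (N : Λ n) →
            σ k ≡ N → ρ k ≡ nothing → RenamedBy σ ρ → (∀ i → ρ i ≡ nothing → i ≡ k ⊎ occ i M ≡ 0) →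
            occ k M ≡ 1 → net (sub σ M) ⇔ exec (substCircuit k ρ (net M) (net N))
net-subst (var j) σ k ρ N σk ρk σ≈ρ erased once with occ-var-≡ k j once
... | refl rewrite σk = subst-var k ρ (net N) ρk (net-noDead N)
net-subst (app A B) σ k ρ N σk ρk σ≈ρ erased once with m+n≡1-cases (occ k A) (occ k B) once
... | inj₁ (onceA , noneB) =
  ⇔-trans (app-cong (net-subst A σ k ρ N σk ρk σ≈ρ erasedA onceA) (net-rename B σ ρ σ≈ρ unusedB))
  (⇔-trans AppOfSub.flatten
  (⇔-trans (⇔-sym (exec-invariant morphism))
           (⇔-sym SubOfApp.flatten)))
  where
  erasedA : ∀ i → ρ i ≡ nothing → i ≡ k ⊎ occ i A ≡ 0
  erasedA i eq = Sum.map₂ (occ-appˡ A B) (erased i eq)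
  unusedB : ∀ i → ρ i ≡ nothing → occ i B ≡ 0
  unusedB i eq with erased i eq
  ... | inj₁ refl = noneB
  ... | inj₂ none = occ-appʳ A B none
  open SubstFun k ρ (net A) (net B) (net N) ρk (λ i eq → net-absent B i (unusedB i eq))
... | inj₂ (noneA , onceB) =
  ⇔-trans (app-cong (net-rename A σ ρ σ≈ρ unusedA) (net-subst B σ k ρ N σk ρk σ≈ρ erasedB onceB))
  (⇔-trans (exec-invariant (app-mirror _ _))
  (⇔-trans AppOfSub.flatten
  (⇔-trans (⇔-sym (exec-invariant morphism))
           (⇔-sym SubOfApp.flatten))))
  where
  erasedB : ∀ i → ρ i ≡ nothing → i ≡ k ⊎ occ i B ≡ 0
  erasedB i eq = Sum.map₂ (occ-appʳ A B) (erased i eq)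
  unusedA : ∀ i → ρ i ≡ nothing → occ i A ≡ 0
  unusedA i eq with erased i eq
  ... | inj₁ refl = noneA
  ... | inj₂ none = occ-appˡ A B none
  open SubstArg k ρ (net A) (net B) (net N) ρk (λ i eq → net-absent A i (unusedA i eq))
net-subst (lam M) σ k ρ N σk ρk σ≈ρ erased once =
  ⇔-trans (≡⇒⇔ (cong net (sub-lam σ M)))
  (⇔-trans (image-cong lamPort (net-subst M (liftSub σ) (suc k) (liftRen ρ) (ren suc N)
                                  (cong (ren suc) σk) (map-nothing ρk) (liftSub-renamedBy σ≈ρ) erased′ once))
  (⇔-trans (image-cong lamPort (exec-cong-box (substCircuit (suc k) (liftRen ρ) (net M) (net (ren suc N)))
                                              (⊕-cong ⇔-refl (net-ren suc N))))
  (⇔-trans (image-exec lamPort _)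
           (exec-invariant (subst-lam-morphism k ρ (net M) (net N))))))
  where
  erased′ : ∀ i → liftRen ρ i ≡ nothing → i ≡ suc k ⊎ occ i M ≡ 0
  erased′ (suc i) eq with ρ i in ρi
  erased′ (suc i) refl | nothing = Sum.map (cong suc) (λ none → none) (erased i ρi)

lamPort-out-l : ∀ {n} {x : Port (suc n)} {u} → lamPort x ≡ out (l u) → x ≡ at zero u
lamPort-out-l {x = out _} ()
lamPort-out-l {x = at zero _} refl = refl
lamPort-out-l {x = at (suc _) _} ()
lamPort-out-l {x = dead} ()

dropZero : ∀ {n} → PartialRenaming (suc n) n
dropZero zero    = nothing
dropZero (suc i) = just i

substZero : ∀ {n} → Λ n → Fin (suc n) → Λ n
substZero N zero    = N
substZero N (suc i) = var i

module _ {n} (R : RelOn (Port (suc n))) (Q : RelOn (Port n)) where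

  private
    θ : Port (suc n) ⊎ Port n → Port n ⊎ Port n
    θ (inj₁ p) = inj₁ (lamPort p)
    θ (inj₂ q) = inj₂ q

    box-reflect : ∀ {x y} → (Image lamPort R ⊕ Q) x y → ∃₂ λ s t → θ s ≡ x × θ t ≡ y × (R ⊕ Q) s t
    box-reflect (inj₁ (x , y , refl , refl , a)) = inj₁ x , inj₁ y , refl , refl , inj₁ a
    box-reflect (inj₂ q) = inj₂ _ , inj₂ _ , refl , refl , inj₂ q

    wire-reflect : ∀ t {z w} → AppWire (θ t) z → (Image lamPort R ⊕ Q) z w →
                   ∃₂ λ s' t' → SubWire zero t s' × (R ⊕ Q) s' t' × θ s' ≡ z × θ t' ≡ w
    wire-reflect (inj₁ (at zero w)) fun↦arg (inj₂ q) = inj₂ _ , inj₂ _ , var↦arg , inj₂ q , refl , refl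
    wire-reflect (inj₂ (out w)) arg↦fun (inj₁ (x , y , eq , refl , a)) with lamPort-out-l eq
    ... | refl = inj₁ _ , inj₁ y , arg↦var , inj₁ a , refl , refl

    entry-preserve : ∀ {x s} → SubEntry dropZero x s → AppEntry x (θ s)
    entry-preserve sub-out = app-out
    entry-preserve (sub-body {suc i} refl) = app-fun
    entry-preserve sub-arg = app-arg

    entry-reflect : ∀ {x} s → AppEntry x (θ s) → SubEntry dropZero x s
    entry-reflect (inj₁ (out w)) app-out = sub-out
    entry-reflect (inj₁ (at (suc i) w)) app-fun = sub-body {i = suc i} refl
    entry-reflect (inj₂ (at j w)) app-arg = sub-arg

  -- A β-redex is a substitution circuit read through the abstraction.
  beta-morphism : CircuitMorphism (substCircuit zero dropZero R Q) (appCircuit (Image lamPort R) Q)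
  beta-morphism = record
    { node = θ
    ; box-preserve = λ { (inj₁ a) → inj₁ (_ , _ , refl , refl , a) ; (inj₂ q) → inj₂ q }
    ; box-reflect = box-reflect
    ; wire-preserve = λ { _ var↦arg _ → fun↦arg ; _ arg↦var _ → arg↦fun }
    ; wire-reflect = λ {t = t} _ w b → wire-reflect t w b
    ; entry-preserve = λ j _ → entry-preserve j
    ; entry-reflect = λ {s = s} j _ → entry-reflect s j }

net-beta : ∀ {n} (M : Λ (suc n)) (N : Λ n) → occ zero M ≡ 1 → net (app (lam M) N) ⇔ net (M [ N /0])
net-beta M N once =
  ⇔-trans (⇔-sym (exec-invariant (beta-morphism (net M) (net N))))
  (⇔-trans (⇔-sym (net-subst M (substZero N) zero dropZero N refl refl renamed erased once))
           (≡⇒⇔ (cong net (sub-ext (λ { zero → refl ; (suc i) → refl }) M))))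
  where
  renamed : RenamedBy (substZero N) dropZero
  renamed (suc i) .i refl = refl
  erased : ∀ i → dropZero i ≡ nothing → i ≡ zero ⊎ occ i M ≡ 0
  erased zero _ = inj₁ refl

net-sound : ∀ {n} {M N : Λ n} → false ⊢ M ≈ N → net M ⇔ net N
net-sound (β {M} {N} (wf-app (wf-lam _ once) _)) = net-beta M N once
net-sound (ξ d _ _)     = image-cong lamPort (net-sound d)
net-sound (cong· d₁ d₂) = app-cong (net-sound d₁) (net-sound d₂)
net-sound (refl _)      = ⇔-refl
net-sound (sym d)       = ⇔-sym (net-sound d)
net-sound (trans d₁ d₂) = ⇔-trans (net-sound d₁) (net-sound d₂)

outPart : ∀ {n} → RelOn (Port n) → Rel
outPart R u v = R (out u) (out v)

outPart-cong : ∀ {n} {R Q : RelOn (Port n)} → R ⇔ Q → outPart R ⇔ outPart Q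
outPart-cong (f , g) = f , g

-- Relations are passed as explicit implicit arguments throughout: an equation f x y = f a b
-- between applications of a relation variable f does not determine x and y.
·-mono : ∀ {f f' g g' : Rel} → f ⇒ f' → g ⇒ g' → (f · g) ⇒ (f' · g')
·-mono hf hg (inj₁ p) = inj₁ (hf p)
·-mono {f} {f'} {g} {g'} hf hg {u} {v} (inj₂ (a , p , (b , q , (c , st , p')))) =
  inj₂ (a , hf {r u} {l a} p , (b , hg q , (c , loops st , hf {l c} {r v} p')))
  where
  loops : Star ((f [ l , l ]) ⨾ g) ⇒ Star ((f' [ l , l ]) ⨾ g')
  loops ε = ε
  loops (_◅_ {a} (y , p , q) st) = (y , hf {l a} {l y} p , hg q) ◅ loops st

·-cong : ∀ {f f' g g' : Rel} → f ⇔ f' → g ⇔ g' → (f · g) ⇔ (f' · g')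
·-cong {f} {f'} {g} {g'} (f→f' , f'→f) (g→g' , g'→g) =
  ·-mono {f} {f'} {g} {g'} f→f' g→g' , ·-mono {f'} {f} {g'} {g} f'→f g'→g

outPart-app : ∀ {n} (R Q : RelOn (Port n)) → outPart (exec (appCircuit R Q)) ⇔ (outPart R · outPart Q)
outPart-app {n} R Q = forth , back
  where
  C : Circuit (Port n)
  C = appCircuit R Q

  loops-back : ∀ {w₁ y₀ v} → Q (out w₁) y₀ → Star (wire C ⨟ box C) (inj₂ y₀) (inj₁ (out (r v))) →
               (outPart Q ⨾ (Star ((outPart R [ l , l ]) ⨾ outPart Q) ⨾ (outPart R [ l , r ]))) w₁ v
  loops-back q ((_ , arg↦fun , inj₁ p) ◅ ε) = _ , q , (_ , ε , p)
  loops-back q ((_ , arg↦fun , inj₁ p) ◅ ((_ , fun↦arg , inj₂ q') ◅ st)) with loops-back q' st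
  ... | _ , q'' , (w , st' , p') = _ , q , (w , ((_ , p , q'') ◅ st') , p')

  loops-forth : ∀ {w₂ w₃ v} → Star ((outPart R [ l , l ]) ⨾ outPart Q) w₂ w₃ → (outPart R [ l , r ]) w₃ v →
                Star (wire C ⨟ box C) (inj₂ (out w₂)) (inj₁ (out (r v)))
  loops-forth ε p = (_ , arg↦fun , inj₁ p) ◅ ε
  loops-forth ((_ , p , q) ◅ st) p' = (_ , arg↦fun , inj₁ p) ◅ ((_ , fun↦arg , inj₂ q) ◅ loops-forth st p')

  forth : outPart (exec C) ⇒ (outPart R · outPart Q)
  forth (_ , _ , app-out , app-out , (_ , inj₁ p , ε)) = inj₁ p
  forth (_ , _ , app-out , app-out , (_ , inj₁ p , ((_ , fun↦arg , inj₂ q) ◅ st))) = inj₂ (_ , p , loops-back q st)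

  back : (outPart R · outPart Q) ⇒ outPart (exec C)
  back (inj₁ p) = _ , _ , app-out , app-out , (_ , inj₁ p , ε)
  back (inj₂ (_ , p , (_ , q , (_ , st , p')))) =
    _ , _ , app-out , app-out , (_ , inj₁ p , ((_ , fun↦arg , inj₂ q) ◅ loops-forth st p'))

data varAppNet {n} (i : Fin n) (Q : RelOn (Port n)) : RelOn (Port n) where
  out↦fun  : ∀ {u} → varAppNet i Q (out u) (at i (r u))
  fun↦out  : ∀ {u} → varAppNet i Q (at i (r u)) (out u)
  fun↦fun  : ∀ {u u'} → Q (out u) (out u') → varAppNet i Q (at i (l u)) (at i (l u'))
  fun↦arg  : ∀ {u j w} → Q (out u) (at j w) → varAppNet i Q (at i (l u)) (at j w)
  arg↦fun  : ∀ {u j w} → Q (at j w) (out u) → varAppNet i Q (at j w) (at i (l u))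
  arg↦arg  : ∀ {j w j' w'} → Q (at j w) (at j' w') → varAppNet i Q (at j w) (at j' w')

varApp-net : ∀ {n} (i : Fin n) (Q : RelOn (Port n)) → exec (appCircuit (varNet i) Q) ⇔ varAppNet i Q
varApp-net {n} i Q = forth , back
  where
  C : Circuit (Port n)
  C = appCircuit (varNet i) Q

  after-arg : ∀ {y y₀ s'} → Star (wire C ⨟ box C) (inj₂ y₀) s' → AppEntry y s' →
              (∃₂ λ j w → y₀ ≡ at j w × y ≡ at j w) ⊎ (∃ λ u → y₀ ≡ out u × y ≡ at i (l u))
  after-arg ε app-arg = inj₁ (_ , _ , refl , refl)
  after-arg ((_ , arg↦fun , inj₁ out↦at) ◅ ε) app-fun = inj₂ (_ , refl , refl)
  after-arg ((_ , arg↦fun , inj₁ out↦at) ◅ ((_ , () , _) ◅ _)) _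

  forth : exec C ⇒ varAppNet i Q
  forth (_ , _ , app-out , app-fun , (_ , inj₁ out↦at , ε)) = out↦fun
  forth (_ , _ , app-out , _ , (_ , inj₁ out↦at , ((_ , () , _) ◅ _)))
  forth (_ , _ , app-fun , app-out , (_ , inj₁ at↦out , ε)) = fun↦out
  forth (_ , _ , app-fun , j , (_ , inj₁ at↦out , ((_ , fun↦arg , inj₂ q) ◅ st))) with after-arg st j
  ... | inj₁ (_ , _ , refl , refl) = fun↦arg q
  ... | inj₂ (_ , refl , refl) = fun↦fun q
  forth (_ , _ , app-arg , j , (_ , inj₂ q , st)) with after-arg st j
  ... | inj₁ (_ , _ , refl , refl) = arg↦arg q
  ... | inj₂ (_ , refl , refl) = arg↦fun q

  back : varAppNet i Q ⇒ exec C
  back out↦fun = _ , _ , app-out , app-fun , (_ , inj₁ out↦at , ε)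
  back fun↦out = _ , _ , app-fun , app-out , (_ , inj₁ at↦out , ε)
  back (fun↦fun q) = _ , _ , app-fun , app-fun ,
    (_ , inj₁ at↦out , ((_ , fun↦arg , inj₂ q) ◅ ((_ , arg↦fun , inj₁ out↦at) ◅ ε)))
  back (fun↦arg q) = _ , _ , app-fun , app-arg , (_ , inj₁ at↦out , ((_ , fun↦arg , inj₂ q) ◅ ε))
  back (arg↦fun q) = _ , _ , app-arg , app-fun , (_ , inj₂ q , ((_ , arg↦fun , inj₁ out↦at) ◅ ε))
  back (arg↦arg q) = _ , _ , app-arg , app-arg , (_ , inj₂ q , ε)

data ArgVar {n} (j : Fin n) : Port n → Port n → Set where
  res-port : ∀ {u} → ArgVar j (out (r u)) (out u)
  arg-port : ∀ {w} → ArgVar j (out (l w)) (at j w)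
  var-port : ∀ {k w} → ArgVar j (at k w) (at k w)

data appVarNet {n} (P : RelOn (Port n)) (j : Fin n) : RelOn (Port n) where
  app-var : ∀ {a b a' b'} → P a b → ArgVar j a a' → ArgVar j b b' → appVarNet P j a' b'

appVar-net : ∀ {n} (P : RelOn (Port n)) (j : Fin n) → exec (appCircuit P (varNet j)) ⇔ appVarNet P j
appVar-net {n} P j = forth , back
  where
  C : Circuit (Port n)
  C = appCircuit P (varNet j)

  after-fun : ∀ {a a' t₀ y s'} → P a t₀ → ArgVar j a a' → Star (wire C ⨟ box C) (inj₁ t₀) s' →
              AppEntry y s' → appVarNet P j a' y
  after-fun p ta ε app-out = app-var p ta res-port
  after-fun p ta ε app-fun = app-var p ta var-port
  after-fun p ta ((_ , fun↦arg , inj₂ out↦at) ◅ ε) app-arg = app-var p ta arg-port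
  after-fun p ta ((_ , fun↦arg , inj₂ out↦at) ◅ ((_ , () , _) ◅ _)) _

  exit : ∀ {b b'} → ArgVar j b b' → ∃ λ s' → AppEntry b' s' × Star (wire C ⨟ box C) (inj₁ b) s'
  exit res-port = _ , app-out , ε
  exit arg-port = _ , app-arg , ((_ , fun↦arg , inj₂ out↦at) ◅ ε)
  exit var-port = _ , app-fun , ε

  forth : exec C ⇒ appVarNet P j
  forth (_ , _ , app-out , en , (_ , inj₁ p , st)) = after-fun p res-port st en
  forth (_ , _ , app-fun , en , (_ , inj₁ p , st)) = after-fun p var-port st en
  forth (_ , _ , app-arg , en , (_ , inj₂ at↦out , ((_ , arg↦fun , inj₁ p) ◅ st))) = after-fun p arg-port st en

  back : appVarNet P j ⇒ exec C
  back (app-var p ta tb) with exit tb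
  back (app-var p res-port _) | s' , en , st = _ , s' , app-out , en , (_ , inj₁ p , st)
  back (app-var p var-port _) | s' , en , st = _ , s' , app-fun , en , (_ , inj₁ p , st)
  back (app-var p arg-port _) | s' , en , st =
    _ , s' , app-arg , en , (_ , inj₂ at↦out , ((_ , arg↦fun , inj₁ p) ◅ st))

lam³Port : Port 3 → Port 0
lam³Port p = lamPort (lamPort (lamPort p))

image-lam³ : (X : RelOn (Port 3)) → Image lamPort (Image lamPort (Image lamPort X)) ⇔ Image lam³Port X
image-lam³ X = ⇔-trans (image-cong lamPort (image-∘ lamPort lamPort (λ p → lamPort (lamPort p)) (λ _ → refl)))
                       (image-∘ (λ p → lamPort (lamPort p)) lamPort lam³Port (λ _ → refl))

𝑥 𝑦 𝑧 : Fin 3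
𝑥 = suc (suc zero)
𝑦 = suc zero
𝑧 = zero

B-body : RelOn (Port 3)
B-body = varAppNet 𝑥 (varAppNet 𝑦 (varNet 𝑧))

net-B : net (toλ {false} `B) ⇔ Image lam³Port B-body
net-B = ⇔-trans (image-cong lamPort (image-cong lamPort (image-cong lamPort
                  (⇔-trans (app-cong ⇔-refl (varApp-net 𝑦 (varNet 𝑧))) (varApp-net 𝑥 _)))))
                (image-lam³ B-body)

B-body-out : outPart (Image lam³Port B-body) ⇔ Bᴾ
B-body-out = forth , back
  where
  forth : outPart (Image lam³Port B-body) ⇒ Bᴾ
  forth (_ , _ , refl , refl , out↦fun {w}) = b₁ w
  forth (_ , _ , refl , refl , fun↦out {w}) = b₁' w
  forth (_ , _ , refl , refl , fun↦arg (out↦fun {w})) = b₂ w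
  forth (_ , _ , refl , refl , arg↦fun (fun↦out {w})) = b₂' w
  forth (_ , _ , refl , refl , arg↦arg (fun↦arg (out↦at {w}))) = b₃ w
  forth (_ , _ , refl , refl , arg↦arg (arg↦fun (at↦out {w}))) = b₃' w
  back : Bᴾ ⇒ outPart (Image lam³Port B-body)
  back (b₁ w)  = out w , at 𝑥 (r w) , refl , refl , out↦fun
  back (b₁' w) = at 𝑥 (r w) , out w , refl , refl , fun↦out
  back (b₂ w)  = at 𝑥 (l w) , at 𝑦 (r w) , refl , refl , fun↦arg out↦fun
  back (b₂' w) = at 𝑦 (r w) , at 𝑥 (l w) , refl , refl , arg↦fun fun↦out
  back (b₃ w)  = at 𝑦 (l w) , at 𝑧 w , refl , refl , arg↦arg (fun↦arg out↦at)
  back (b₃' w) = at 𝑧 w , at 𝑦 (l w) , refl , refl , arg↦arg (arg↦fun at↦out)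

C-body : RelOn (Port 3)
C-body = appVarNet (varAppNet 𝑥 (varNet 𝑧)) 𝑦

net-C : net (toλ {false} `C) ⇔ Image lam³Port C-body
net-C = ⇔-trans (image-cong lamPort (image-cong lamPort (image-cong lamPort
                  (⇔-trans (app-cong (varApp-net 𝑥 (varNet 𝑧)) ⇔-refl) (appVar-net _ 𝑦)))))
                (image-lam³ C-body)

C-body-out : outPart (Image lam³Port C-body) ⇔ Cᴾ
C-body-out = forth , back
  where
  forth : outPart (Image lam³Port C-body) ⇒ Cᴾ
  forth (_ , _ , refl , refl , app-var out↦fun (res-port {w}) var-port) = c₃' w
  forth (_ , _ , refl , refl , app-var out↦fun (arg-port {w}) var-port) = c₂' w
  forth (_ , _ , refl , refl , app-var fun↦out var-port (res-port {w})) = c₃ w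
  forth (_ , _ , refl , refl , app-var fun↦out var-port (arg-port {w})) = c₂ w
  forth (_ , _ , refl , refl , app-var (fun↦arg (out↦at {w})) var-port var-port) = c₁ w
  forth (_ , _ , refl , refl , app-var (arg↦fun (at↦out {w})) var-port var-port) = c₁' w
  back : Cᴾ ⇒ outPart (Image lam³Port C-body)
  back (c₁ w)  = at 𝑥 (l w) , at 𝑧 w , refl , refl , app-var (fun↦arg out↦at) var-port var-port
  back (c₁' w) = at 𝑧 w , at 𝑥 (l w) , refl , refl , app-var (arg↦fun at↦out) var-port var-port
  back (c₂ w)  = at 𝑥 (r (l w)) , at 𝑦 w , refl , refl , app-var fun↦out var-port arg-port
  back (c₂' w) = at 𝑦 w , at 𝑥 (r (l w)) , refl , refl , app-var out↦fun arg-port var-port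
  back (c₃ w)  = at 𝑥 (r (r w)) , out w , refl , refl , app-var fun↦out var-port res-port
  back (c₃' w) = out w , at 𝑥 (r (r w)) , refl , refl , app-var out↦fun res-port var-port

I-out : Iᴾ ⇔ outPart (net (toλ {false} `I))
I-out = (λ { (i₁ w)  → at zero w , out w , refl , refl , at↦out
            ; (i₁' w) → out w , at zero w , refl , refl , out↦at })
      , (λ { (_ , _ , refl , refl , out↦at {w}) → i₁' w ; (_ , _ , refl , refl , at↦out {w}) → i₁ w })

⟦⟧-net : ∀ (M : CL false) → ⟦ M ⟧ ⇔ outPart (net (toλ M))
⟦⟧-net `B       = ⇔-sym (⇔-trans (outPart-cong net-B) B-body-out)
⟦⟧-net `C       = ⇔-sym (⇔-trans (outPart-cong net-C) C-body-out)
⟦⟧-net `I       = I-out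
⟦⟧-net (cst _)  = con↦ , λ { (con↦ h) → h }
⟦⟧-net (M `· N) = ⇔-trans (·-cong (⟦⟧-net M) (⟦⟧-net N)) (⇔-sym (outPart-app (net (toλ M)) (net (toλ N))))

⇔⇒≐ : ∀ {f g : Rel} → f ⇔ g → f ≐ g
⇔⇒≐ (f , g) u v = f , g

linear-λ-algebra : IsStrictlyLinearλAlgebra
linear-λ-algebra M N M≈N =
  ⇔⇒≐ (⇔-trans (⟦⟧-net M) (⇔-trans (outPart-cong (net-sound M≈N)) (⇔-sym (⟦⟧-net N))))

at-most-once : ∀ {k} {_ : True (k ≤? 1)} → k ≤ 1
at-most-once {_} {p} = toWitness p

Bᵗ Cᵗ Kᵗ last₂ last₃ : ∀ {n} → Λ n
Bᵗ    = lam (lam (lam (app (var (suc (suc zero))) (app (var (suc zero)) (var zero)))))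
Cᵗ    = lam (lam (lam (app (app (var (suc (suc zero))) (var zero)) (var (suc zero)))))
Kᵗ    = lam (lam (var (suc zero)))
last₂ = lam (lam (var zero))
last₃ = lam (lam (lam (var zero)))

wf-B : ∀ {n} → WF true {n} Bᵗ
wf-B = wf-lam (wf-lam (wf-lam (wf-app wf-var (wf-app wf-var wf-var)) at-most-once) at-most-once) at-most-once

wf-C : ∀ {n} → WF true {n} Cᵗ
wf-C = wf-lam (wf-lam (wf-lam (wf-app (wf-app wf-var wf-var) wf-var) at-most-once) at-most-once) at-most-once

wf-K : ∀ {n} → WF true {n} Kᵗ
wf-K = wf-lam (wf-lam wf-var at-most-once) at-most-once

wf-last₂ : ∀ {n} → WF true {n} last₂
wf-last₂ = wf-lam (wf-lam wf-var at-most-once) at-most-once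

CK≈last₂ : true ⊢ toλ (`C `· `K) ≈ last₂
CK≈last₂ =
  trans (β (wf-app wf-C wf-K))
        (ξ (ξ (trans (cong· (β (wf-app wf-K wf-var)) (refl wf-var))
                     (β (wf-app (wf-lam wf-var at-most-once) wf-var)))
              at-most-once at-most-once)
           at-most-once at-most-once)

B[CK]≈last₃ : true ⊢ toλ (`B `· (`C `· `K)) ≈ last₃
B[CK]≈last₃ =
  trans (cong· (refl wf-B) CK≈last₂)
        (trans (β (wf-app wf-B wf-last₂))
               (ξ (ξ (β (wf-app wf-last₂ (wf-app wf-var wf-var))) at-most-once at-most-once)
                  at-most-once at-most-once))

K[CK]≈last₃ : true ⊢ toλ (`K `· (`C `· `K)) ≈ last₃
K[CK]≈last₃ = trans (cong· (refl wf-K) CK≈last₂) (β (wf-app wf-K wf-last₂))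

B·-relates : ∀ g → (Bᴾ · g) (l (l e)) (r (l e))
B·-relates g = inj₁ (b₃ e)

K·-unrelated : ∀ g → ¬ (Kᴾ · g) (l (l e)) (r (l e))
K·-unrelated g (inj₁ ())
K·-unrelated g (inj₂ (_ , () , _))

not-affine-λ-algebra : ¬ IsStrictlyAffineλAlgebra
not-affine-λ-algebra isAlgebra = K·-unrelated _ (proj₁ (B[CK]≐K[CK] _ _) (B·-relates _))
  where
  B[CK]≐K[CK] : ⟦ `B `· (`C `· `K) ⟧ ≐ ⟦ `K `· (`C `· `K) ⟧
  B[CK]≐K[CK] = isAlgebra (`B `· (`C `· `K)) (`K `· (`C `· `K)) (trans B[CK]≈last₃ (sym K[CK]≈last₃))

data Nil : Rel where

nilᴾ : PInv
nilᴾ = Nil , record { functional = λ () ; injective = λ () ; symmetric = λ () }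

data Swap (b j : Tm) : Rel where
  b↦j : Swap b j b j
  j↦b : Swap b j j b

swapᴾ : Tm → Tm → PInv
swapᴾ b j = Swap b j , record { functional = functional ; injective = injective ; symmetric = symmetric }
  where
  functional : ∀ {u v w} → Swap b j u v → Swap b j u w → v ≡ w
  functional b↦j b↦j = refl
  functional b↦j j↦b = refl
  functional j↦b b↦j = refl
  functional j↦b j↦b = refl
  injective : ∀ {u v w} → Swap b j u w → Swap b j v w → u ≡ v
  injective b↦j b↦j = refl
  injective b↦j j↦b = refl
  injective j↦b b↦j = refl
  injective j↦b j↦b = refl
  symmetric : ∀ {u v} → Swap b j u v → Swap b j v u
  symmetric b↦j = j↦b
  symmetric j↦b = b↦j

Iᴾ-pinv : PInv
Iᴾ-pinv = Iᴾ , record { functional = functional ; injective = injective ; symmetric = symmetric }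
  where
  functional : ∀ {u v w} → Iᴾ u v → Iᴾ u w → v ≡ w
  functional (i₁ _) (i₁ _) = refl
  functional (i₁' _) (i₁' _) = refl
  injective : ∀ {u v w} → Iᴾ u w → Iᴾ v w → u ≡ v
  injective (i₁ _) (i₁ _) = refl
  injective (i₁' _) (i₁' _) = refl
  symmetric : ∀ {u v} → Iᴾ u v → Iᴾ v u
  symmetric (i₁ x) = i₁' x
  symmetric (i₁' x) = i₁ x

·-nilʳ : ∀ {f u v} → (f · Nil) u v → f (r u) (r v)
·-nilʳ (inj₁ p) = p
·-nilʳ (inj₂ (_ , _ , (_ , () , _)))

nil·-empty : ∀ {g u v} → ¬ (Nil · g) u v
nil·-empty (inj₁ ())
nil·-empty (inj₂ (_ , () , _))

swap-l·-empty : ∀ {a b g u v} → ¬ (Swap (l a) (l b) · g) u v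
swap-l·-empty (inj₁ ())
swap-l·-empty (inj₂ (_ , () , _))

module NotModel (model : IsStrictlyLinearCombλModel) where
  E : Rel
  E = proj₁ (proj₁ model)
  open IsPInv (proj₂ (proj₁ model))

  ε·x·y≐x·y : ∀ (x y : PInv) → (E · proj₁ x · proj₁ y) ≐ (proj₁ x · proj₁ y)
  ε·x·y≐x·y x y = proj₁ (proj₂ model x y)

  -- Applications of both Z = {l e ↔ l e} and ∅ are empty.
  ε·Z≐ε·∅ : (E · Swap (l e) (l e)) ≐ (E · Nil)
  ε·Z≐ε·∅ = proj₂ (proj₂ model (swapᴾ (l e) (l e)) nilᴾ)
    λ _ u v → (λ p → ⊥-elim (swap-l·-empty p)) , (λ p → ⊥-elim (nil·-empty p))

  ε-r↛ll : ∀ {u} → ¬ E (r u) (l (l e))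
  ε-r↛ll {u} p
    with functional p (·-nilʳ {E} (proj₁ (ε·Z≐ε·∅ u u) (inj₂ (_ , p , (_ , b↦j , (_ , ε , symmetric p))))))
  ... | ()

  ε-rr↛rl : ¬ E (r (r e)) (r (l e))
  ε-rr↛rl p = nil·-empty (proj₁ (ε·x·y≐x·y nilᴾ (swapᴾ e e) e e)
                           (inj₂ (_ , inj₁ p , (_ , b↦j , (_ , ε , inj₁ (symmetric p))))))

  swap·Y : ∀ {b j} → E (r (r e)) (l b) → E (l j) (r (l e)) → (Swap b j · Swap e e) e e
  swap·Y p q = proj₁ (ε·x·y≐x·y (swapᴾ _ _) (swapᴾ e e) e e)
                     (inj₂ (_ , ε·X-out , (_ , b↦j , (_ , ε , ε·X-in))))
    where
    ε·X-out : (E · Swap _ _) (r e) (l e)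
    ε·X-out = inj₂ (_ , p , (_ , b↦j , (_ , ε , q)))
    ε·X-in : (E · Swap _ _) (l e) (r e)
    ε·X-in = inj₂ (_ , symmetric q , (_ , j↦b , (_ , ε , symmetric p)))

  ε-rr-rl-unlinked : ∀ {b j} → E (r (r e)) (l b) → ¬ E (l j) (r (l e))
  ε-rr-rl-unlinked p q with swap·Y p q
  ... | inj₁ b↦j with functional (symmetric p) q
  ...   | ()
  ε-rr-rl-unlinked p q | inj₁ j↦b with functional (symmetric p) q
  ...   | ()
  ε-rr-rl-unlinked p q | inj₂ (_ , b↦j , (_ , b↦j , _)) = ε-r↛ll (symmetric q)
  ε-rr-rl-unlinked p q | inj₂ (_ , b↦j , (_ , j↦b , _)) = ε-r↛ll (symmetric q)
  ε-rr-rl-unlinked p q | inj₂ (_ , j↦b , (_ , b↦j , _)) = ε-r↛ll p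
  ε-rr-rl-unlinked p q | inj₂ (_ , j↦b , (_ , j↦b , _)) = ε-r↛ll p

  ε·I-loop : ((E · Iᴾ) · Swap e e) e e
  ε·I-loop = proj₂ (ε·x·y≐x·y Iᴾ-pinv (swapᴾ e e) e e) (inj₂ (e , i₁' e , (e , b↦j , (e , ε , i₁ e))))

  ε·I↛rr : ¬ (E · Iᴾ) (r e) (r e)
  ε·I↛rr p with ·-nilʳ {Iᴾ} (proj₁ (ε·x·y≐x·y Iᴾ-pinv nilᴾ e e) (inj₁ p))
  ... | ()

  absurd : ⊥
  absurd with ε·I-loop
  ... | inj₁ p = ε·I↛rr p
  absurd | inj₂ (_ , inj₁ p , (_ , b↦j , _)) = ε-rr↛rl p
  absurd | inj₂ (_ , inj₁ p , (_ , j↦b , _)) = ε-rr↛rl p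
  absurd | inj₂ (_ , inj₂ (_ , p , (_ , _ , (_ , _ , q))) , (_ , b↦j , _)) = ε-rr-rl-unlinked p q
  absurd | inj₂ (_ , inj₂ (_ , p , (_ , _ , (_ , _ , q))) , (_ , j↦b , _)) = ε-rr-rl-unlinked p q

not-linear-combinatory-λ-model : ¬ IsStrictlyLinearCombλModel
not-linear-combinatory-λ-model = NotModel.absurd

mainTheorem8 : (IsStrictlyLinearλAlgebra × ¬ IsStrictlyLinearCombλModel)
    × ¬ IsStrictlyAffineλAlgebra
mainTheorem8 = (linear-λ-algebra , not-linear-combinatory-λ-model) , not-affine-λ-algebra
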